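{- Let $t\ge 5$ and $l\ge 16$ be integers. Every double crossed $t$-cylinder of length $l$ contains $K_6$ as a minor.
   Context: Let $k,l\ge 3$. Let $P_1,\dots,P_k$ be vertex-disjoint paths, $P_i$ having vertices $v^i_1,\dots,v^i_l$ with $v^i_j$ adjacent to $v^i_{j+1}$ for $1\le j\le l-1$. A double crossed $k$-cylinder of length $l$ has vertex set $\{v^i_j:1\le j\le l,1\le i\le k\}$ and edge set $\bigcup_{i=1}^kE(P_i)\cup\{v^i_jv^{i+1}_j:1\le i\le k,1\le j\le l\}\cup\{q_1,q_2,r_1,r_2\}$, superscripts taken modulo $k$, where: $q_i$ has ends $u_i,v_i\in\{v^1_1,\dots,v^k_1\}$ ($i=1,2$) and $u_1,u_2,v_1,v_2$ occur in this order in the cyclic order $(v^1_1,v^2_1,\dots,v^k_1)$; and $r_i$ has ends $x_i,y_i\in\{v^1_l,\dots,v^k_l\}$ ($i=1,2$) and $x_1,x_2,y_1,y_2$ occur in this order in the cyclic order $(v^1_l,v^2_l,\dots,v^k_l)$. -}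

module Defs where

open import Data.Nat using (ℕ; zero; suc; _<_; pred)
open import Data.Fin using (Fin; toℕ)
open import Data.Product using (_×_; _,_; Σ; ∃; ∃-syntax)
open import Data.Sum using (_⊎_)
open import Data.Maybe using (Maybe; just; nothing)
open import Relation.Binary.PropositionalEquality using (_≡_; _≢_)

record Graph : Set₁ where
  field
    V   : Set
    Adj : V → V → Set

open Graph public

data WalkIn {V : Set} (Adj : V → V → Set) (P : V → Set) : V → V → Set where
  here : ∀ {x} → P x → WalkIn Adj P x x
  step : ∀ {x y z} → P x → Adj x y → WalkIn Adj P y z → WalkIn Adj P x z

-- Branch sets are encoded by a partial assignment β : V → Maybe (Fin n)
-- (vertices mapped to nothing are deleted), which makes disjointness automatic.
record KMinor (n : ℕ) (G : Graph) : Set where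
  field
    β         : V G → Maybe (Fin n)
    nonempty  : (i : Fin n) → ∃[ v ] (β v ≡ just i)
    connected : (i : Fin n) (x y : V G) → β x ≡ just i → β y ≡ just i →
                WalkIn (Adj G) (λ v → β v ≡ just i) x y
    adjacent  : (i j : Fin n) → i ≢ j →
                ∃[ x ] ∃[ y ] (β x ≡ just i × β y ≡ just j × Adj G x y)

HasKMinor : ℕ → Graph → Set
HasKMinor n G = KMinor n G

CyclicOrder4 : {k : ℕ} → Fin k → Fin k → Fin k → Fin k → Set
CyclicOrder4 a b c d =
     (A < B × B < C × C < D)
  ⊎ ((B < C × C < D × D < A)
  ⊎ ((C < D × D < A × A < B)
  ⊎  (D < A × A < B × B < C)))
  where
    A = toℕ a
    B = toℕ b
    C = toℕ c
    D = toℕ d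

-- Vertex v^i_j is represented by (i , j) with i : Fin k (0-based, i.e. v^{i+1}_{j+1})
-- and j : Fin l.  Row j = 0 is the first row, row toℕ j = l - 1 is the last one.
-- Directed edge list; the graph's adjacency is its symmetric closure.
data CylEdge (k l : ℕ) (u₁ v₁ u₂ v₂ x₁ y₁ x₂ y₂ : Fin k) : Fin k × Fin l → Fin k × Fin l → Set where
  path  : ∀ i j j' → toℕ j' ≡ suc (toℕ j) → CylEdge k l u₁ v₁ u₂ v₂ x₁ y₁ x₂ y₂ (i , j) (i , j')
  rung  : ∀ i i' j → toℕ i' ≡ suc (toℕ i) → CylEdge k l u₁ v₁ u₂ v₂ x₁ y₁ x₂ y₂ (i , j) (i' , j)
  wrap  : ∀ i i' j → suc (toℕ i) ≡ k → toℕ i' ≡ 0 → CylEdge k l u₁ v₁ u₂ v₂ x₁ y₁ x₂ y₂ (i , j) (i' , j)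
  q₁    : ∀ j → toℕ j ≡ 0 → CylEdge k l u₁ v₁ u₂ v₂ x₁ y₁ x₂ y₂ (u₁ , j) (v₁ , j)
  q₂    : ∀ j → toℕ j ≡ 0 → CylEdge k l u₁ v₁ u₂ v₂ x₁ y₁ x₂ y₂ (u₂ , j) (v₂ , j)
  r₁    : ∀ j → toℕ j ≡ pred l → CylEdge k l u₁ v₁ u₂ v₂ x₁ y₁ x₂ y₂ (x₁ , j) (y₁ , j)
  r₂    : ∀ j → toℕ j ≡ pred l → CylEdge k l u₁ v₁ u₂ v₂ x₁ y₁ x₂ y₂ (x₂ , j) (y₂ , j)

DoubleCrossedCylinder : (k l : ℕ) (u₁ v₁ u₂ v₂ x₁ y₁ x₂ y₂ : Fin k) → Graph
DoubleCrossedCylinder k l u₁ v₁ u₂ v₂ x₁ y₁ x₂ y₂ = record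
  { V   = Fin k × Fin l
  ; Adj = λ a b → E a b ⊎ E b a
  }
  where E = CylEdge k l u₁ v₁ u₂ v₂ x₁ y₁ x₂ y₂

-- Contract every row from the fifth on into the fifth row, and every column that
-- carries no chord end into the nearest such column on its left (the columns
-- before the first one joining it).  The result is a double crossed cylinder of
-- length 5 and width at most 8; when the two pairs of chords have the same ends
-- one further column is kept, so that the width is 5.  K₆ minors lift along
-- contractions, so it suffices to find K₆ in each of these finitely many small
-- cylinders.  For each, a certificate lists the branch sets as trees given by
-- parent pointers, together with an edge between every two of them, and is
-- checked by evaluation.

module Submission where

open import Defs
open import Data.Bool using (Bool; true; false; _∧_; _∨_; not; T; if_then_else_)
open import Data.Bool.ListAction using (any)
open import Data.Bool.Properties using (T-∧; T-∨)
open import Data.Empty using (⊥-elim)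
open import Data.Fin using (Fin; toℕ; fromℕ<)
open import Data.Fin.Properties using (toℕ-injective; toℕ<n; fromℕ<-toℕ; toℕ-fromℕ<; pigeonhole; any?)
open import Data.List using (List; []; _∷_; _++_; length; lookup; map)
open import Data.List.Properties using (∷-injective; length-map; ≡-dec)
open import Data.List.Membership.Propositional using (_∈_; _∉_)
open import Data.List.Membership.Propositional.Properties using (∈-map⁺; ∈-map⁻; ∈-++⁻; ∈-++⁺ˡ; ∈-++⁺ʳ)
open import Data.List.Relation.Unary.Any as Any using (index; here; there)
open import Data.List.Relation.Unary.Any.Properties using (any⁺; any⁻; lookup-index)
open import Data.Maybe using (Maybe; just; nothing)
open import Data.Nat using (ℕ; zero; suc; _≤_; _<_; _+_; _*_; _∸_; pred; _⊓_; _≡ᵇ_; _<ᵇ_; _<?_; NonZero; z≤n; s≤s; s≤s⁻¹; z<s; >-nonZero)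
open import Data.Nat.DivMod using (_/_; _%_)
open import Data.Nat.Properties
open import Data.List.Membership.DecPropositional _≟_ using (_∈?_)
open import Data.Product using (_×_; _,_; proj₁; proj₂; ∃-syntax; ∃₂)
open import Data.Sum using (_⊎_; inj₁; inj₂)
open import Function using (_∘′_)
open import Function.Bundles using (Equivalence)
open import Relation.Binary using (_Preserves_⟶_; tri<; tri≈; tri>)
open import Relation.Binary.PropositionalEquality
open import Relation.Nullary using (¬_; yes; no; contradiction; ¬?)
open import Relation.Nullary.Decidable using (⌊_⌋; decidable-stable; toWitness; fromWitness)

module _ {V : Set} {Adj : V → V → Set} where

  walk-target : ∀ {P : V → Set} {x y} → WalkIn Adj P x y → P y
  walk-target (here p)     = p
  walk-target (step _ _ w) = walk-target w

  _++ʷ_ : ∀ {P : V → Set} {x y z} → WalkIn Adj P x y → WalkIn Adj P y z → WalkIn Adj P x z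
  here _     ++ʷ w' = w'
  step p e w ++ʷ w' = step p e (w ++ʷ w')

  walk-reverse : (∀ {x y} → Adj x y → Adj y x) →
                 ∀ {P : V → Set} {x y} → WalkIn Adj P x y → WalkIn Adj P y x
  walk-reverse sym (here p)     = here p
  walk-reverse sym (step p e w) = let w' = walk-reverse sym w in w' ++ʷ step (walk-target w') (sym e) (here p)

  walk-map : ∀ {P Q : V → Set} → (∀ {v} → P v → Q v) → ∀ {x y} → WalkIn Adj P x y → WalkIn Adj Q x y
  walk-map f (here p)     = here (f p)
  walk-map f (step p e w) = step (f p) e (walk-map f w)

module _ {V : Set} {Adj : V → V → Set} {P : V → Set} {n : ℕ} (f : Fin n → V)
         (next : ∀ a b → toℕ b ≡ suc (toℕ a) → Adj (f a) (f b)) where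

  lineWalk : ∀ a b → toℕ a ≤ toℕ b → (∀ k → toℕ a ≤ toℕ k → toℕ k ≤ toℕ b → P (f k)) →
             WalkIn Adj P (f a) (f b)
  lineWalk a b a≤b inside = go (toℕ b ∸ toℕ a) a (sym (m∸n+n≡m a≤b)) inside
    where
    go : ∀ d a → toℕ b ≡ d + toℕ a → (∀ k → toℕ a ≤ toℕ k → toℕ k ≤ toℕ b → P (f k)) →
         WalkIn Adj P (f a) (f b)
    go zero a b≡a inside =
      subst (WalkIn Adj P (f a) ∘′ f) (toℕ-injective (sym b≡a)) (here (inside a ≤-refl (≤-reflexive (sym b≡a))))
    go (suc d) a b≡d+1+a inside =
      step (inside a ≤-refl (≤-trans (m≤n+m (toℕ a) (suc d)) (≤-reflexive (sym b≡d+1+a))))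
           (next a a⁺ (toℕ-fromℕ< a+1<n))
           (go d a⁺ (trans b≡d+1+a (trans (sym (+-suc d (toℕ a))) (cong (d +_) (sym (toℕ-fromℕ< a+1<n)))))
               (λ k a⁺≤k k≤b → inside k (≤-trans (n≤1+n (toℕ a)) (subst (_≤ toℕ k) (toℕ-fromℕ< a+1<n) a⁺≤k)) k≤b))
      where
      a+1<n : suc (toℕ a) < n
      a+1<n = ≤-<-trans (subst (suc (toℕ a) ≤_) (sym b≡d+1+a) (s≤s (m≤n+m (toℕ a) d))) (toℕ<n b)
      a⁺ : Fin n
      a⁺ = fromℕ< a+1<n

record Contraction (G H : Graph) : Set where
  field
    φ          : V G → V H
    section    : V H → V G
    φ-section  : ∀ h → φ (section h) ≡ h
    fibre-walk : ∀ x y → φ x ≡ φ y → WalkIn (Adj G) (λ v → φ v ≡ φ x) x y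
    lift-edge  : ∀ h h' → Adj H h h' → ∃₂ λ x y → φ x ≡ h × φ y ≡ h' × Adj G x y

liftMinor : ∀ {n G H} → Contraction G H → KMinor n H → KMinor n G
liftMinor {n} {G} {H} M K = record
  { β         = λ v → β (φ v)
  ; nonempty  = λ i → let (h , βh) = nonempty i in section h , trans (cong β (φ-section h)) βh
  ; connected = λ i x y βx βy → liftWalk (connected i (φ x) (φ y) βx βy) x y refl refl
  ; adjacent  = λ i j i≢j →
      let (h , h' , βh , βh' , e) = adjacent i j i≢j
          (x , y , φx , φy , e')  = lift-edge h h' e
      in x , y , trans (cong β φx) βh , trans (cong β φy) βh' , e'
  }
  where
  open Contraction M
  open KMinor K

  inFibre : ∀ {i h x} → β h ≡ just i → φ x ≡ h → ∀ {v} → φ v ≡ φ x → β (φ v) ≡ just i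
  inFibre βh φx φv = trans (cong β (trans φv φx)) βh

  liftWalk : ∀ {i h h'} → WalkIn (Adj H) (λ v → β v ≡ just i) h h' → ∀ x y → φ x ≡ h → φ y ≡ h' →
             WalkIn (Adj G) (λ v → β (φ v) ≡ just i) x y
  liftWalk (here βh) x y φx φy = walk-map (inFibre βh φx) (fibre-walk x y (trans φx (sym φy)))
  liftWalk (step βh e w) x y φx φy =
    let (x' , y' , φx' , φy' , e') = lift-edge _ _ e in
    walk-map (inFibre βh φx) (fibre-walk x x' (trans φx (sym φx')))
      ++ʷ step (trans (cong β φx') βh) e' (liftWalk w y' y φy' φy)

∧⁻ : ∀ {a b} → T (a ∧ b) → T a × T b
∧⁻ {a} {b} = Equivalence.to (T-∧ {a} {b})

∧⁺ : ∀ {a b} → T a → T b → T (a ∧ b)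
∧⁺ {a} {b} p q = Equivalence.from (T-∧ {a} {b}) (p , q)

∨⁻ : ∀ {a b} → T (a ∨ b) → T a ⊎ T b
∨⁻ {a} {b} = Equivalence.to (T-∨ {a} {b})

∨⁺ : ∀ {a b} → T a ⊎ T b → T (a ∨ b)
∨⁺ {a} {b} = Equivalence.from (T-∨ {a} {b})

≡ᵇ-sound : ∀ {m n} → T (m ≡ᵇ n) → m ≡ n
≡ᵇ-sound {m} {n} = ≡ᵇ⇒≡ m n

≡ᵇ³-sound : ∀ {a b c x y z} → T ((a ≡ᵇ x) ∧ ((b ≡ᵇ y) ∧ (c ≡ᵇ z))) → a ≡ x × b ≡ y × c ≡ z
≡ᵇ³-sound {a} {b} {x = x} {y} p =
  let (e₁ , p₂) = ∧⁻ {a ≡ᵇ x} p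
      (e₂ , e₃) = ∧⁻ {b ≡ᵇ y} p₂
  in ≡ᵇ-sound e₁ , ≡ᵇ-sound e₂ , ≡ᵇ-sound e₃

≡ᵇ⁴-sound : ∀ {a b c d x y z u} → T ((a ≡ᵇ x) ∧ ((b ≡ᵇ y) ∧ ((c ≡ᵇ z) ∧ (d ≡ᵇ u)))) →
            a ≡ x × b ≡ y × c ≡ z × d ≡ u
≡ᵇ⁴-sound {a} {x = x} p = let (e₁ , p₂) = ∧⁻ {a ≡ᵇ x} p in ≡ᵇ-sound e₁ , ≡ᵇ³-sound p₂

implication-elim : ∀ {a b} → T a → T (not a ∨ b) → T b
implication-elim {true} _ p = p

not⁺ : ∀ {b} → ¬ T b → T (not b)
not⁺ {true}  ¬b = ¬b _
not⁺ {false} _  = _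

allUpTo : ℕ → (ℕ → Bool) → Bool
allUpTo zero    f = true
allUpTo (suc n) f = allUpTo n f ∧ f n

allUpTo-sound : ∀ n f → T (allUpTo n f) → ∀ c → c < n → T (f c)
allUpTo-sound (suc n) f h c c<1+n with m≤n⇒m<n∨m≡n (s≤s⁻¹ c<1+n)
... | inj₁ c<n  = allUpTo-sound n f (proj₁ (∧⁻ h)) c c<n
... | inj₂ refl = proj₂ (∧⁻ {allUpTo n f} h)

allUpTo-complete : ∀ n f → (∀ c → c < n → T (f c)) → T (allUpTo n f)
allUpTo-complete zero    f h = _
allUpTo-complete (suc n) f h = ∧⁺ (allUpTo-complete n f (λ c c<n → h c (m<n⇒m<1+n c<n))) (h n ≤-refl)

anyUpTo : ℕ → (ℕ → Bool) → Bool
anyUpTo zero    f = false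
anyUpTo (suc n) f = anyUpTo n f ∨ f n

anyUpTo-complete : ∀ n f c → c < n → T (f c) → T (anyUpTo n f)
anyUpTo-complete (suc n) f c c<1+n fc with m≤n⇒m<n∨m≡n (s≤s⁻¹ c<1+n)
... | inj₁ c<n  = ∨⁺ (inj₁ (anyUpTo-complete n f c c<n fc))
... | inj₂ refl = ∨⁺ {anyUpTo n f} (inj₂ fc)

allFrom : ℕ → ℕ → (ℕ → Bool) → Bool
allFrom m n f = allUpTo (n ∸ m) (λ d → f (m + d))

allFrom-sound : ∀ m n f → T (allFrom m n f) → ∀ c → m ≤ c → c < n → T (f c)
allFrom-sound m n f h c m≤c c<n =
  subst (T ∘′ f) (m+[n∸m]≡n m≤c) (allUpTo-sound (n ∸ m) (λ d → f (m + d)) h (c ∸ m) (∸-monoˡ-< c<n m≤c))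

allIncreasing4 : ℕ → (ℕ → ℕ → ℕ → ℕ → Bool) → Bool
allIncreasing4 n f =
  allUpTo n λ a → allFrom (suc a) n λ b → allFrom (suc b) n λ c → allFrom (suc c) n λ d → f a b c d

allIncreasing4-sound : ∀ n f → T (allIncreasing4 n f) →
                       ∀ {a b c d} → a < b → b < c → c < d → d < n → T (f a b c d)
allIncreasing4-sound n f h {a} {b} {c} {d} a<b b<c c<d d<n = allFrom-sound (suc c) n (f a b c) hd d c<d d<n
  where
  c<n = <-trans c<d d<n
  b<n = <-trans b<c c<n
  a<n = <-trans a<b b<n
  ha = allUpTo-sound n _ h a a<n
  hb = allFrom-sound (suc a) n (λ b → allFrom (suc b) n λ c → allFrom (suc c) n (f a b c)) ha b a<b b<n
  hd = allFrom-sound (suc b) n (λ c → allFrom (suc c) n (f a b c)) hb c b<c c<n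

flat-between : ∀ {f : ℕ → ℕ} → f Preserves _≤_ ⟶ _≤_ →
               ∀ {i j k} → i ≤ k → k ≤ j → f i ≡ f j → f k ≡ f i
flat-between {f} mono {k = k} i≤k k≤j fi≡fj =
  ≤-antisym (subst (f k ≤_) (sym fi≡fj) (mono k≤j)) (mono i≤k)

pred-< : ∀ {n} → 0 < n → pred n < n
pred-< {suc n} _ = ≤-refl

covered-≤-length : ∀ k (xs : List ℕ) → (∀ c → c < k → c ∈ xs) → k ≤ length xs
covered-≤-length k xs covered with length xs <? k
... | no  k≰ = ≮⇒≥ k≰
... | yes len<k =
  let (i , j , i<j , same) = pigeonhole len<k (λ c → index (covered (toℕ c) (toℕ<n c))) in
  contradiction (lookups-agree i j same) (<⇒≢ i<j)
  where
  lookups-agree : ∀ i j → index (covered (toℕ i) (toℕ<n i)) ≡ index (covered (toℕ j) (toℕ<n j)) → toℕ i ≡ toℕ j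
  lookups-agree i j same = begin
    toℕ i                                           ≡⟨ lookup-index (covered (toℕ i) (toℕ<n i)) ⟩
    lookup xs (index (covered (toℕ i) (toℕ<n i)))   ≡⟨ cong (lookup xs) same ⟩
    lookup xs (index (covered (toℕ j) (toℕ<n j)))   ≡⟨ sym (lookup-index (covered (toℕ j) (toℕ<n j))) ⟩
    toℕ j                                           ∎
    where open ≡-Reasoning

fresh : ∀ xs → ∃[ e ] e ≤ length xs × e ∉ xs
fresh xs with any? (λ (e : Fin (suc (length xs))) → ¬? (toℕ e ∈? xs))
... | yes (e , e∉xs) = toℕ e , s≤s⁻¹ (toℕ<n e) , e∉xs
... | no  none      = contradiction (covered-≤-length (suc (length xs)) xs covered) (<-irrefl refl)
  where
  covered : ∀ c → c < suc (length xs) → c ∈ xs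
  covered c c<n = decidable-stable (c ∈? xs) (λ c∉xs → none (fromℕ< c<n , subst (_∉ xs) (sym (toℕ-fromℕ< c<n)) c∉xs))

-- A marked column goes to the number of marked columns before it; an unmarked
-- column joins the nearest marked column on its left, and the columns before the
-- first marked one join that one (as pred 0 = 0).
module Squash (marked : ℕ → Bool) where

  count : ℕ → ℕ
  count zero    = 0
  count (suc i) = if marked i then suc (count i) else count i

  count-step : ∀ i → count i ≤ count (suc i)
  count-step i with marked i
  ... | true  = n≤1+n _
  ... | false = ≤-refl

  count-mono : count Preserves _≤_ ⟶ _≤_
  count-mono {i} {zero} z≤n = ≤-refl
  count-mono {i} {suc j} i≤1+j with m≤n⇒m<n∨m≡n i≤1+j
  ... | inj₁ i<1+j = ≤-trans (count-mono (s≤s⁻¹ i<1+j)) (count-step j)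
  ... | inj₂ refl  = ≤-refl

  count-marked : ∀ {i} → T (marked i) → count (suc i) ≡ suc (count i)
  count-marked {i} mi with marked i
  ... | true = refl

  count-hit : ∀ n k → k < count n → ∃[ s ] s < n × T (marked s) × count s ≡ k
  count-hit (suc n) k k< with marked n in eq
  ... | false = let (s , s<n , ms , cs) = count-hit n k k< in s , m<n⇒m<1+n s<n , ms , cs
  ... | true with m≤n⇒m<n∨m≡n (s≤s⁻¹ k<)
  ...   | inj₁ k<c = let (s , s<n , ms , cs) = count-hit n k k<c in s , m<n⇒m<1+n s<n , ms , cs
  ...   | inj₂ refl = n , ≤-refl , subst T (sym eq) _ , refl

  squash : ℕ → ℕ
  squash i = pred (count (suc i))

  squash-mono : squash Preserves _≤_ ⟶ _≤_
  squash-mono i≤j = pred-mono-≤ (count-mono (s≤s i≤j))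

  squash-marked : ∀ {i} → T (marked i) → squash i ≡ count i
  squash-marked mi = cong pred (count-marked mi)

  squash-strict : ∀ {i j} → T (marked i) → T (marked j) → i < j → squash i < squash j
  squash-strict {i} {j} mi mj i<j = begin-strict
    squash i          ≡⟨ squash-marked mi ⟩
    count i           <⟨ n<1+n (count i) ⟩
    suc (count i)     ≡⟨ count-marked mi ⟨
    count (suc i)     ≤⟨ count-mono i<j ⟩
    count j           ≡⟨ squash-marked mj ⟨
    squash j          ∎
    where open ≤-Reasoning

  squash-injective : ∀ {i j} → T (marked i) → T (marked j) → squash i ≡ squash j → i ≡ j
  squash-injective {i} {j} mi mj eq with <-cmp i j
  ... | tri< i<j _ _ = contradiction eq (<⇒≢ (squash-strict mi mj i<j))
  ... | tri≈ _ i≡j _ = i≡j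
  ... | tri> _ _ j<i = contradiction (sym eq) (<⇒≢ (squash-strict mj mi j<i))

  squash-< : ∀ {i n} → i < n → 0 < count n → squash i < count n
  squash-< {i} {n} i<n 0<c = ≤-<-trans (pred-mono-≤ (count-mono i<n)) (pred-< 0<c)

  squash-zero : squash 0 ≡ 0
  squash-zero with marked 0
  ... | true  = refl
  ... | false = refl

  squash-hit : ∀ {n k} → k < count n → ∃[ s ] s < n × T (marked s) × squash s ≡ k
  squash-hit {n} {k} k< = let (s , s<n , ms , cs) = count-hit n k k< in s , s<n , ms , trans (squash-marked ms) cs

  squash-step : ∀ {n k} → suc k < count n → ∃[ s ] suc s < n × squash s ≡ k × squash (suc s) ≡ suc k
  squash-step {n} {k} k< with count-hit n (suc k) k<
  ... | suc s , s<n , ms , cs = s , s<n , cong pred cs , trans (squash-marked ms) cs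

  squash-list-injective : ∀ {xs ys} → (∀ {x} → x ∈ xs → T (marked x)) → (∀ {y} → y ∈ ys → T (marked y)) →
                          map squash xs ≡ map squash ys → xs ≡ ys
  squash-list-injective {[]}     {[]}     _  _  _  = refl
  squash-list-injective {x ∷ xs} {y ∷ ys} mx my eq =
    let (hd , tl) = ∷-injective eq in
    cong₂ _∷_ (squash-injective (mx (here refl)) (my (here refl)) hd)
              (squash-list-injective (λ x∈ → mx (there x∈)) (λ y∈ → my (there y∈)) tl)

  squash-∈ : ∀ {x xs} → T (marked x) → (∀ {y} → y ∈ xs → T (marked y)) → squash x ∈ map squash xs → x ∈ xs
  squash-∈ {xs = xs} mx mxs p =
    let (y , y∈xs , eq) = ∈-map⁻ squash p in subst (_∈ xs) (sym (squash-injective mx (mxs y∈xs) eq)) y∈xs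

record Certificate : Set where
  constructor certificate
  field labels parents ranks roots witnesses : ℕ

digit : (b : ℕ) .{{_ : NonZero b}} → ℕ → ℕ → ℕ
digit b N zero    = N % b
digit b N (suc k) = digit b (N / b) k

decodeVertex : ℕ → ℕ × ℕ
decodeVertex v = v / 8 , v % 8

-- Pattern matching on n makes the checker evaluate n once, instead of once
-- per occurrence of the bound variable in k.
force : ℕ → (ℕ → Bool) → Bool
force zero    k = k zero
force (suc n) k = k (suc n)

force-sound : ∀ n k → T (force n k) → T (k n)
force-sound zero    k p = p
force-sound (suc n) k p = p

force₂ : ℕ → ℕ → (ℕ → ℕ → Bool) → Bool
force₂ c r k = force c λ c → force r λ r → k c r

force₂-sound : ∀ c r k → T (force₂ c r k) → T (k c r)
force₂-sound c r k p = force-sound r (k c) (force-sound c (λ c → force r (k c)) p)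

BoolGrid : (w h : ℕ) → (ℕ → ℕ → ℕ → ℕ → Bool) → Graph
BoolGrid w h adj = record
  { V   = Fin w × Fin h
  ; Adj = λ { (c , r) (c' , r') → T (adj (toℕ c) (toℕ r) (toℕ c') (toℕ r')) }
  }

-- Vertex (c , r) has label
-- digit (c * h + r) of labels in base 8 (labels ≥ n delete the vertex); a labelled
-- vertex is the root of its branch set or is adjacent to its parent, which has the
-- same label and smaller rank; witnesses lists an edge between branch sets i < j.
-- Vertices are stored as base-64 digits 8 c + r.
module MinorCertificate (w h n : ℕ) (adj : ℕ → ℕ → ℕ → ℕ → Bool) (C : Certificate) where
  open Certificate C

  label : ℕ → ℕ → ℕ
  label c r = digit 8 labels (c * h + r)

  parent : ℕ → ℕ → ℕ × ℕ
  parent c r = decodeVertex (digit 64 parents (c * h + r))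

  rank : ℕ → ℕ → ℕ
  rank c r = digit 64 ranks (c * h + r)

  root : ℕ → ℕ × ℕ
  root i = decodeVertex (digit 64 roots i)

  witness : ℕ → ℕ → (ℕ × ℕ) × (ℕ × ℕ)
  witness i j = decodeVertex (digit 64 witnesses (2 * (i * n + j))) ,
                decodeVertex (digit 64 witnesses (suc (2 * (i * n + j))))

  inGrid : ℕ → ℕ → Bool
  inGrid c r = (c <ᵇ w) ∧ (r <ᵇ h)

  isRoot : ℕ → ℕ → ℕ → Bool
  isRoot c r i = (c ≡ᵇ proj₁ (root i)) ∧ (r ≡ᵇ proj₂ (root i))

  parentLink : ℕ → ℕ → ℕ → ℕ → ℕ → Bool
  parentLink c r i c' r' = inGrid c' r' ∧ ((label c' r' ≡ᵇ i) ∧ ((rank c' r' <ᵇ rank c r) ∧ adj c r c' r'))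

  validParent : ℕ → ℕ → ℕ → ℕ × ℕ → Bool
  validParent c r i (c' , r') = force₂ c' r' (parentLink c r i)

  validVertex : ℕ → ℕ → Bool
  validVertex c r = force (label c r) λ i → not (i <ᵇ n) ∨ (isRoot c r i ∨ validParent c r i (parent c r))

  rootLabel : ℕ → ℕ → ℕ → Bool
  rootLabel i c r = inGrid c r ∧ (label c r ≡ᵇ i)

  validRoot : ℕ → Bool
  validRoot i = force₂ (proj₁ (root i)) (proj₂ (root i)) (rootLabel i)

  witnessEdge : ℕ → ℕ → ℕ → ℕ → ℕ → ℕ → Bool
  witnessEdge i j c r c' r' = inGrid c r ∧ (inGrid c' r' ∧ ((label c r ≡ᵇ i) ∧ ((label c' r' ≡ᵇ j) ∧ adj c r c' r')))

  validWitness' : ℕ → ℕ → (ℕ × ℕ) × (ℕ × ℕ) → Bool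
  validWitness' i j ((c , r) , (c' , r')) = force₂ c r λ c r → force₂ c' r' (witnessEdge i j c r)

  validWitness : ℕ → ℕ → Bool
  validWitness i j = validWitness' i j (witness i j)

  validVertices validRoots validWitnesses valid : Bool
  validVertices  = allUpTo w (λ c → allUpTo h (validVertex c))
  validRoots     = allUpTo n validRoot
  validWitnesses = allUpTo n (λ i → allUpTo n (λ j → not (i <ᵇ j) ∨ validWitness i j))
  valid          = validVertices ∧ (validRoots ∧ validWitnesses)

  module Sound (adj-sym : ∀ c r c' r' → T (adj c r c' r') → T (adj c' r' c r)) (ok : T valid) where

    G : Graph
    G = BoolGrid w h adj

    vertices-ok : T validVertices
    vertices-ok = proj₁ (∧⁻ {validVertices} ok)

    roots-ok : T validRoots
    roots-ok = proj₁ (∧⁻ {validRoots} (proj₂ (∧⁻ {validVertices} ok)))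

    witnesses-ok : T validWitnesses
    witnesses-ok = proj₂ (∧⁻ {validRoots} (proj₂ (∧⁻ {validVertices} ok)))

    point : (c r : ℕ) → .(c < w) → .(r < h) → V G
    point c r c<w r<h = fromℕ< c<w , fromℕ< r<h

    point-cong : ∀ {c r c' r'} .{c<w r<h c'<w r'<h} → c ≡ c' → r ≡ r' →
                 point c r c<w r<h ≡ point c' r' c'<w r'<h
    point-cong refl refl = refl

    point-toℕ : (x : V G) → point (toℕ (proj₁ x)) (toℕ (proj₂ x)) (toℕ<n (proj₁ x)) (toℕ<n (proj₂ x)) ≡ x
    point-toℕ (c , r) = cong₂ _,_ (fromℕ<-toℕ c (toℕ<n c)) (fromℕ<-toℕ r (toℕ<n r))

    edge : ∀ {c r c' r'} .{c<w r<h c'<w r'<h} → T (adj c r c' r') →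
           Adj G (point c r c<w r<h) (point c' r' c'<w r'<h)
    edge {c} {r} {c'} {r'} {c<w} {r<h} {c'<w} {r'<h} e =
      subst T (sym (cong₂ (λ a b → adj a b _ _) (toℕ-fromℕ< c<w) (toℕ-fromℕ< r<h)))
        (subst T (sym (cong₂ (adj c r) (toℕ-fromℕ< c'<w) (toℕ-fromℕ< r'<h))) e)

    edge-sym : ∀ {x y} → Adj G x y → Adj G y x
    edge-sym {c , r} {c' , r'} = adj-sym (toℕ c) (toℕ r) (toℕ c') (toℕ r')

    decodeLabel : ℕ → Maybe (Fin n)
    decodeLabel k with k <? n
    ... | yes k<n = just (fromℕ< k<n)
    ... | no _    = nothing

    decodeLabel-toℕ : ∀ i → decodeLabel (toℕ i) ≡ just i
    decodeLabel-toℕ i with toℕ i <? n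
    ... | yes i<n = cong just (fromℕ<-toℕ i i<n)
    ... | no i≮n  = ⊥-elim (i≮n (toℕ<n i))

    decodeLabel-just : ∀ k i → decodeLabel k ≡ just i → k ≡ toℕ i
    decodeLabel-just k i eq with k <? n
    decodeLabel-just k ._ refl | yes k<n = sym (toℕ-fromℕ< k<n)

    β : V G → Maybe (Fin n)
    β (c , r) = decodeLabel (label (toℕ c) (toℕ r))

    β-point : ∀ {c r} (c<w : c < w) (r<h : r < h) {i} → label c r ≡ toℕ i → β (point c r c<w r<h) ≡ just i
    β-point {c} {r} c<w r<h {i} eq = begin
      decodeLabel (label (toℕ (fromℕ< c<w)) (toℕ (fromℕ< r<h))) ≡⟨ cong₂ (λ a b → decodeLabel (label a b)) (toℕ-fromℕ< c<w) (toℕ-fromℕ< r<h) ⟩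
      decodeLabel (label c r)                                   ≡⟨ cong decodeLabel eq ⟩
      decodeLabel (toℕ i)                                       ≡⟨ decodeLabel-toℕ i ⟩
      just i                                                    ∎
      where open ≡-Reasoning

    inGrid-sound : ∀ c r → T (inGrid c r) → c < w × r < h
    inGrid-sound c r p = let (c<w , r<h) = ∧⁻ {c <ᵇ w} p in <ᵇ⇒< c w c<w , <ᵇ⇒< r h r<h

    root-ok : (i : Fin n) → T (rootLabel (toℕ i) (proj₁ (root (toℕ i))) (proj₂ (root (toℕ i))))
    root-ok i = force₂-sound _ _ (rootLabel (toℕ i)) (allUpTo-sound n validRoot roots-ok (toℕ i) (toℕ<n i))

    root-inGrid : (i : Fin n) → proj₁ (root (toℕ i)) < w × proj₂ (root (toℕ i)) < h
    root-inGrid i = inGrid-sound _ _ (proj₁ (∧⁻ {inGrid _ _} (root-ok i)))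

    branchRoot : Fin n → V G
    branchRoot i = point _ _ (proj₁ (root-inGrid i)) (proj₂ (root-inGrid i))

    β-branchRoot : ∀ i → β (branchRoot i) ≡ just i
    β-branchRoot i = β-point (proj₁ (root-inGrid i)) (proj₂ (root-inGrid i)) (≡ᵇ-sound (proj₂ (∧⁻ {inGrid _ _} (root-ok i))))

    Branch : Fin n → V G → Set
    Branch i v = β v ≡ just i

    vertex-ok : ∀ c r → c < w → r < h → T (validVertex c r)
    vertex-ok c r c<w r<h = allUpTo-sound h (validVertex c) (allUpTo-sound w _ vertices-ok c c<w) r r<h

    -- Parents have smaller rank, so fuel > rank c r suffices.
    pathToRoot : ∀ fuel c r i (c<w : c < w) (r<h : r < h) → rank c r < fuel → label c r ≡ toℕ i →
                 WalkIn (Adj G) (Branch i) (point c r c<w r<h) (branchRoot i)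
    pathToRoot (suc fuel) c r i c<w r<h rank<fuel lab≡i with ∨⁻ (implication-elim (<⇒<ᵇ (toℕ<n i)) labelled)
      where
      labelled : T (not (toℕ i <ᵇ n) ∨ (isRoot c r (toℕ i) ∨ validParent c r (toℕ i) (parent c r)))
      labelled = subst (λ k → T (not (k <ᵇ n) ∨ (isRoot c r k ∨ validParent c r k (parent c r))))
                   lab≡i (force-sound (label c r) _ (vertex-ok c r c<w r<h))
    ... | inj₁ isroot =
      let (c≡ , r≡) = ∧⁻ {c ≡ᵇ _} isroot in
      subst (WalkIn _ _ _) (point-cong (≡ᵇ-sound c≡) (≡ᵇ-sound r≡)) (here (β-point c<w r<h lab≡i))
    ... | inj₂ link =
      let (inside , rest)    = ∧⁻ {inGrid c' r'} (force₂-sound c' r' (parentLink c r (toℕ i)) link)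
          (lab'≡i , rest')   = ∧⁻ {label c' r' ≡ᵇ toℕ i} rest
          (smaller , e)      = ∧⁻ {rank c' r' <ᵇ rank c r} rest'
          (c'<w , r'<h)      = inGrid-sound c' r' inside
      in step (β-point c<w r<h lab≡i) (edge e)
              (pathToRoot fuel c' r' i c'<w r'<h (<-≤-trans (<ᵇ⇒< _ _ smaller) (s≤s⁻¹ rank<fuel)) (≡ᵇ-sound lab'≡i))
      where
      c' = proj₁ (parent c r)
      r' = proj₂ (parent c r)

    walkToRoot : ∀ i x → Branch i x → WalkIn (Adj G) (Branch i) x (branchRoot i)
    walkToRoot i (c , r) βx =
      subst (λ x → WalkIn _ _ x _) (point-toℕ (c , r))
        (pathToRoot _ (toℕ c) (toℕ r) i (toℕ<n c) (toℕ<n r) ≤-refl (decodeLabel-just _ i βx))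

    adjacent< : (i j : Fin n) → toℕ i < toℕ j → ∃₂ λ x y → Branch i x × Branch j y × Adj G x y
    adjacent< i j i<j =
      let (inside , rest)   = ∧⁻ {inGrid c r} found
          (inside' , rest') = ∧⁻ {inGrid c' r'} rest
          (labi , rest'')   = ∧⁻ {label c r ≡ᵇ toℕ i} rest'
          (labj , e)        = ∧⁻ {label c' r' ≡ᵇ toℕ j} rest''
          (c<w , r<h)       = inGrid-sound c r inside
          (c'<w , r'<h)     = inGrid-sound c' r' inside'
      in point c r c<w r<h , point c' r' c'<w r'<h , β-point c<w r<h (≡ᵇ-sound labi) , β-point c'<w r'<h (≡ᵇ-sound labj) , edge e
      where
      c  = proj₁ (proj₁ (witness (toℕ i) (toℕ j)))
      r  = proj₂ (proj₁ (witness (toℕ i) (toℕ j)))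
      c' = proj₁ (proj₂ (witness (toℕ i) (toℕ j)))
      r' = proj₂ (proj₂ (witness (toℕ i) (toℕ j)))
      checked : T (validWitness (toℕ i) (toℕ j))
      checked = implication-elim (<⇒<ᵇ i<j)
        (allUpTo-sound n _ (allUpTo-sound n _ witnesses-ok (toℕ i) (toℕ<n i)) (toℕ j) (toℕ<n j))
      found : T (witnessEdge (toℕ i) (toℕ j) c r c' r')
      found = force₂-sound c' r' (witnessEdge (toℕ i) (toℕ j) c r)
                (force₂-sound c r (λ c r → force₂ c' r' (witnessEdge (toℕ i) (toℕ j) c r)) checked)

    kminor : KMinor n G
    kminor = record
      { β         = β
      ; nonempty  = λ i → branchRoot i , β-branchRoot i
      ; connected = λ i x y βx βy → walkToRoot i x βx ++ʷ walk-reverse edge-sym (walkToRoot i y βy)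
      ; adjacent  = adjacent
      }
      where
      adjacent : (i j : Fin n) → i ≢ j → ∃₂ λ x y → Branch i x × Branch j y × Adj G x y
      adjacent i j i≢j with <-cmp (toℕ i) (toℕ j)
      ... | tri< i<j _ _ = adjacent< i j i<j
      ... | tri≈ _ i≡j _ = ⊥-elim (i≢j (toℕ-injective i≡j))
      ... | tri> _ _ j<i = let (y , x , βy , βx , e) = adjacent< j i j<i in x , y , βx , βy , edge-sym {y} {x} e

certifiedMinor : ∀ w h n adj → (∀ c r c' r' → T (adj c r c' r') → T (adj c' r' c r)) →
                 ∀ C → T (MinorCertificate.valid w h n adj C) → KMinor n (BoolGrid w h adj)
certifiedMinor w h n adj adj-sym C = MinorCertificate.Sound.kminor w h n adj C adj-sym

-- The double crossed cylinder of length 5 and the given width, with chords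
-- t₁t₃ and t₂t₄ in row 0 and b₁b₃ and b₂b₄ in row 4.
record Shape : Set where
  constructor shape
  field width t₁ t₂ t₃ t₄ b₁ b₂ b₃ b₄ : ℕ

arc : Shape → ℕ → ℕ → ℕ → ℕ → Bool
arc (shape w t₁ t₂ t₃ t₄ b₁ b₂ b₃ b₄) c r c' r' =
  ((c ≡ᵇ c') ∧ (r' ≡ᵇ suc r)) ∨ ((r ≡ᵇ r') ∧ (c' ≡ᵇ suc c)) ∨ ((r ≡ᵇ r') ∧ ((c ≡ᵇ pred w) ∧ (c' ≡ᵇ 0))) ∨
  ((r ≡ᵇ 0) ∧ ((r' ≡ᵇ 0) ∧ ((c ≡ᵇ t₁) ∧ (c' ≡ᵇ t₃)))) ∨ ((r ≡ᵇ 0) ∧ ((r' ≡ᵇ 0) ∧ ((c ≡ᵇ t₂) ∧ (c' ≡ᵇ t₄)))) ∨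
  ((r ≡ᵇ 4) ∧ ((r' ≡ᵇ 4) ∧ ((c ≡ᵇ b₁) ∧ (c' ≡ᵇ b₃)))) ∨ ((r ≡ᵇ 4) ∧ ((r' ≡ᵇ 4) ∧ ((c ≡ᵇ b₂) ∧ (c' ≡ᵇ b₄))))

shortAdj : Shape → ℕ → ℕ → ℕ → ℕ → Bool
shortAdj s c r c' r' = arc s c r c' r' ∨ arc s c' r' c r

shortAdj-sym : ∀ s c r c' r' → T (shortAdj s c r c' r') → T (shortAdj s c' r' c r)
shortAdj-sym s c r c' r' e with ∨⁻ {arc s c r c' r'} e
... | inj₁ a = ∨⁺ {arc s c' r' c r} (inj₂ a)
... | inj₂ a = ∨⁺ (inj₁ a)

data Arc (s : Shape) (c r c' r' : ℕ) : Set where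
  down      : c ≡ c' → r' ≡ suc r → Arc s c r c' r'
  right     : r ≡ r' → c' ≡ suc c → Arc s c r c' r'
  around    : r ≡ r' → c ≡ pred (Shape.width s) → c' ≡ 0 → Arc s c r c' r'
  top₁₃     : r ≡ 0 → r' ≡ 0 → c ≡ Shape.t₁ s → c' ≡ Shape.t₃ s → Arc s c r c' r'
  top₂₄     : r ≡ 0 → r' ≡ 0 → c ≡ Shape.t₂ s → c' ≡ Shape.t₄ s → Arc s c r c' r'
  bottom₁₃  : r ≡ 4 → r' ≡ 4 → c ≡ Shape.b₁ s → c' ≡ Shape.b₃ s → Arc s c r c' r'
  bottom₂₄  : r ≡ 4 → r' ≡ 4 → c ≡ Shape.b₂ s → c' ≡ Shape.b₄ s → Arc s c r c' r'

arc-cases : ∀ s c r c' r' → T (arc s c r c' r') → Arc s c r c' r'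
arc-cases (shape w t₁ t₂ t₃ t₄ b₁ b₂ b₃ b₄) c r c' r' p
  with ∨⁻ {(c ≡ᵇ c') ∧ (r' ≡ᵇ suc r)} p
... | inj₁ q = let (e₁ , e₂) = ∧⁻ {c ≡ᵇ c'} q in down (≡ᵇ-sound e₁) (≡ᵇ-sound e₂)
... | inj₂ p with ∨⁻ {(r ≡ᵇ r') ∧ (c' ≡ᵇ suc c)} p
... | inj₁ q = let (e₁ , e₂) = ∧⁻ {r ≡ᵇ r'} q in right (≡ᵇ-sound e₁) (≡ᵇ-sound e₂)
... | inj₂ p with ∨⁻ {(r ≡ᵇ r') ∧ ((c ≡ᵇ pred w) ∧ (c' ≡ᵇ 0))} p
... | inj₁ q = let (e₁ , e₂ , e₃) = ≡ᵇ³-sound q in around e₁ e₂ e₃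
... | inj₂ p with ∨⁻ {(r ≡ᵇ 0) ∧ ((r' ≡ᵇ 0) ∧ ((c ≡ᵇ t₁) ∧ (c' ≡ᵇ t₃)))} p
... | inj₁ q = let (e₁ , e₂ , e₃ , e₄) = ≡ᵇ⁴-sound q in top₁₃ e₁ e₂ e₃ e₄
... | inj₂ p with ∨⁻ {(r ≡ᵇ 0) ∧ ((r' ≡ᵇ 0) ∧ ((c ≡ᵇ t₂) ∧ (c' ≡ᵇ t₄)))} p
... | inj₁ q = let (e₁ , e₂ , e₃ , e₄) = ≡ᵇ⁴-sound q in top₂₄ e₁ e₂ e₃ e₄
... | inj₂ p with ∨⁻ {(r ≡ᵇ 4) ∧ ((r' ≡ᵇ 4) ∧ ((c ≡ᵇ b₁) ∧ (c' ≡ᵇ b₃)))} p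
... | inj₁ q = let (e₁ , e₂ , e₃ , e₄) = ≡ᵇ⁴-sound q in bottom₁₃ e₁ e₂ e₃ e₄
... | inj₂ q = let (e₁ , e₂ , e₃ , e₄) = ≡ᵇ⁴-sound q in bottom₂₄ e₁ e₂ e₃ e₄

ShortCylinder : Shape → Graph
ShortCylinder s = BoolGrid (Shape.width s) 5 (shortAdj s)

topEnds bottomEnds : Shape → List ℕ
topEnds    (shape w t₁ t₂ t₃ t₄ b₁ b₂ b₃ b₄) = t₁ ∷ t₂ ∷ t₃ ∷ t₄ ∷ []
bottomEnds (shape w t₁ t₂ t₃ t₄ b₁ b₂ b₃ b₄) = b₁ ∷ b₂ ∷ b₃ ∷ b₄ ∷ []

sameChords : Shape → Bool
sameChords s = ⌊ ≡-dec _≟_ (topEnds s) (bottomEnds s) ⌋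

isIn : ℕ → List ℕ → Bool
isIn c = any (c ≡ᵇ_)

isIn-complete : ∀ {c xs} → c ∈ xs → T (isIn c xs)
isIn-complete {c} c∈xs = any⁺ (c ≡ᵇ_) (Any.map (≡⇒≡ᵇ c _) c∈xs)

isIn-sound : ∀ {c xs} → T (isIn c xs) → c ∈ xs
isIn-sound {c} {xs} p = Any.map (≡ᵇ⇒≡ c _) (any⁻ (c ≡ᵇ_) xs p)

coveredByChords : Shape → Bool
coveredByChords s = allUpTo (Shape.width s) (λ c → isIn c (topEnds s ++ bottomEnds s))

coveredWithSpare : Shape → ℕ → Bool
coveredWithSpare s e = allUpTo (Shape.width s) (λ c → isIn c (e ∷ topEnds s)) ∧ not (isIn e (topEnds s))

reduced : Shape → Bool
reduced s = (coveredByChords s ∧ not (sameChords s)) ∨ (sameChords s ∧ anyUpTo (Shape.width s) (coveredWithSpare s))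

key : Shape → ℕ
key (shape w t₁ t₂ t₃ t₄ b₁ b₂ b₃ b₄) =
  w + 10 * (t₁ + 10 * (t₂ + 10 * (t₃ + 10 * (t₄ + 10 * (b₁ + 10 * (b₂ + 10 * (b₃ + 10 * b₄)))))))

lookupCertificate : ℕ → List (ℕ × Certificate) → Certificate
lookupCertificate k []              = certificate 0 0 0 0 0
lookupCertificate k ((k' , C) ∷ cs) = if k ≡ᵇ k' then C else lookupCertificate k cs

-- Found by a computer search; shapes-certified checks them.
certificateTable : List (ℕ × Certificate)
certificateTable =
  (321032105 , certificate 21586972770700162812736 101940632653818155430381074249431419229569024 23014318735922147620688257739323932231860288 2220950016 112381432183513504069127468316472438750046336397694869470988775896128228182991051794476463381063092051902464)
  ∷ (421032105 , certificate 26982480750017306216704 280346594408216640033061221448616853289566208 45669042666642277037220423817043050332684352 11851072000 1248809996406593938072352343263410934838017224741060646619906568507866186053423257964583277228544800323534848)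
  ∷ (431032105 , certificate 26982480750017306216704 280346594075909641551059767954682691306651648 45669042645543421238202072508028395433754688 11851072000 1248809996406593938072352343263410934838017224741060646619906568507866186053423257964583277228544800323534848)
  ∷ (432032105 , certificate 26982480754415352727808 458752555664154626373860504314524514629713920 68323766576263550577669939988389520231104576 11851072000 1248809996406593938072352343263410934838017224741060646619906568507866186053423257964583277228544800323534848)
  ∷ (432132105 , certificate 26982480754415218510080 458752555830308125982374680098238075165474816 68323766597362406396031104447267038944297024 11851072000 1248809996406593938072352343263410934838017224741060646619906568507866186053423257964583277228544800323534848)
  ∷ (321042105 , certificate 26268987000926830676041 625659493632905418769712052821952351889788928 89562404107814199993758969458130000432603200 10791976992 405375880376245139677409806862828206893743619303694556609526684404838249009659439577535448817086821054939136)
  ∷ (421042105 , certificate 26268987000926830676041 268847570954875946924484012798506215399231488 67261658930382432670584415608330360620851264 10791976992 405375880376245139677409806862828206893743619303694556609526684404838249009659439577535448817086821054939136)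
  ∷ (431042105 , certificate 26932905129744091662409 280346392033254301744122935791529201093316608 23014062152721250733142719050848343662010432 12939460640 1286079348916432600135901909334075175236351638933832027787818276045396421272574290908513404424341091585753088)
  ∷ (432042105 , certificate 26932905129744091662409 458752353621499286876408681972716093141159936 45668701012849649876680346915225744107905088 12939460640 1286079348916432600135901909334075175236351638933832027787818276045396421272574290908513404424341091585753088)
  ∷ (432142105 , certificate 26932905129743957444681 458752353787652786484307622146241676315725824 90977978754205304020792653449655278660231232 18308169760 1286079348916432600135901909334075175236351638933832027787818276045396421272574290908513404424341091585753088)
  ∷ (321043105 , certificate 26648296663014484330770 634011384046612754153591471315409154915958784 113605395046078407299323047165690496722141248 9699330072 368106527866406477613607693836174621716189671348496801255966754660072010505595112169941840860600249369067520)
  ∷ (421043105 , certificate 26648296663014484330770 280335503662126651187641891674054194262179840 90956200724919519761399483453543132717908032 9699330072 368106527866406477613607693836174621716189671348496801255966754660072010505595112169941840860600249369067520)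
  ∷ (431043105 , certificate 26648152547826408474898 280335502999784283635020457041650359353212928 90956200683381144912770703147496050656542784 9699330072 368106527866406477613607693836174621716189671348496801255966754660072010505595112169941840860600249369067520)
  ∷ (432043105 , certificate 26648132286653043690322 781753820820724633612121140275890448432103424 67610108010812667318959518438997029156028480 2216691736 112381432183513504069064285334746344740645611266715936296168121752452363670993896668824721223499819033657344)
  ∷ (432143105 , certificate 26648132286653043690322 781753820986878133085235624388866330967146496 67610108031911443909158168597508157306306624 2216691736 112381432183513504069064285334746344740645611266715936296168121752452363670993896668824721223499819033657344)
  ∷ (321043205 , certificate 26953812171157811874083 634022273082344082979620316670310371341897728 113632617635411799986445862311278706954866688 9680586256 330837175356567815549931823459029870385181662663137793119524434706359437661152519646594026044493747575652352)
  ∷ (421043205 , certificate 26953812171157811874083 280346392697857980013670737028955410688118784 90977978796377106830705971687806447846428672 9680586256 330837175356567815549931823459029870385181662663137793119524434706359437661152519646594026044493747575652352)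
  ∷ (431043205 , certificate 26953668055969736018211 280346392035515612461049302396551575779151872 90977978775607919416216428108905056263737344 9680586256 330837175356567815549931823459029870385181662663137793119524434706359437661152519646594026044493747575652352)
  ∷ (432043205 , certificate 26953650045969273047331 458752353621488967410356671853236908013916160 113632617635411799986752816132665233893756928 9680586256 330837175356567815549931823459029870385181662663137793119524434708798581667241806552699495230564662115368960)
  ∷ (432143205 , certificate 26289567259934051130219 98804388317609128201733097769439832647929856 91331872436881176864559910973850939183075328 1224869392 41856349741818805086905269326212498921541472013338978785993934804741205640664765131838362018749722449215488)
  ∷ (321043215 , certificate 26982624266236767258915 637158485514160386549997049300864060550025216 90978490507642462167024093729078936741613568 10754294792 1211540643896755276008676457472023264235477264198476682995438348456735586607534248993700691798641638385942528)
  ∷ (421043215 , certificate 26982624266236767258915 280346562836130914704769009277417924059467776 68323766597691520223009910535171663670546432 10754294792 1211540643896755276008676457472023264235477264198476682995438348456735586607534248993700691798641638385942528)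
  ∷ (431043215 , certificate 26982480151048691403043 280346562174437584259464428098580401191653376 68323766597361931086595615459520244926124032 10754294792 1211540643896755276008676457472023264235477264198476682995438348456735586607534248993700691798641638385942528)
  ∷ (432043215 , certificate 26982480155446737914147 458752523762682569084380784642747825570451456 90978490528082060426063482939881369723473920 10754294792 1211540643896755276008676457472023264235477264198476682995438348456735586607534248993700691798641638385942528)
  ∷ (432143215 , certificate 26982480155996359510307 458752523928836068688059257148002869407387648 90978490549180837015053207314806665718009856 10754294792 1211540643896755276008676457472023264235477264198476682995438348456736182101676360636011752704204643980312576)
  ∷ (541032106 , certificate 884162685513401934843005184 304060528854780853558417273576321786115215074752200704 49036762577779539615110084244666169335164517128339520 11851072000 1542377819253323091558600554601075399454782425866572394822783818171661508727189997300862756711755600556457984)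
  ∷ (542032106 , certificate 884162685513406332889516288 495622471463016960853210651660625424246212396300369920 73362087173715870110851643259256084938514517132050496 11851072000 1542377819253323091558600554601075399454782425866572394822783818171661508727189997300862756711755600556457984)
  ∷ (543032106 , certificate 884162095361711162259720448 687184414068813923811879374077688621874014199107551232 97687411768955302298369932924562138173224470907715648 11851072000 1542377819253323091558600554601075399454782425866572394822783818171661508727189997300862756711755600556457984)
  ∷ (542132106 , certificate 862099199174291234494929728 109131286650101163189931304917391140676094697063055360 73362087150718226645965794001594166120362749613834304 2338390528 116395054761496129214446420297494010167972259914508885794063849792355106412075673498881518220988996525228032)
  ∷ (543132106 , certificate 862099199174291234494929728 109131286650101163688391803027249583193677275943403520 73362087150718226624866938202575814811348094714904640 2338390528 116395054761496129214446420297494010167972259914508885794063849792355106412075673498881518220988996525228032)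
  ∷ (543232106 , certificate 862099199174286836448418624 109131286828507125276636787850050319553519099266465792 73742168942925788907289948059477867693303657440477248 2338390528 116395054761496129214446420297494010167972259914508885794063849792355106412075673498881518220988996525228032)
  ∷ (531042106 , certificate 884166651567283247698462976 304060529741428893159380600727159981185723840518946816 49036761150913557303891245598435807551066084626137152 11853169152 1542377819253323091558600570015318318726314360655606808979400435858362824423937486403719530533592134179618816)
  ∷ (532042106 , certificate 884166651567287645744974080 495622472349665000454173978811463619316721162067116032 73362085768802183854436386787317758942888382282596416 11853169152 1542377819253323091558600570015318318726314360655606808979400435858362824423937486403719530533592134179618816)
  ∷ (543042106 , certificate 884161929344919964175616256 687184414069007342435864429244939952058654125151748096 97687410341735341276055294048854551308484349656301632 11853169152 1542377819253323091558600570015318318726314360655606808979400435858362824423937486403719530533592134179618816)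
  ∷ (532142106 , certificate 884166651567287645610756352 495622472349665000620327478419977795100434722602876928 73362085769156162607719599011733271655203217520984128 11853169152 1542377819253323091558600570015318318726314360655606808979400435858362824423937486403719530533592134179618816)
  ∷ (543142106 , certificate 884161929344919964041398528 687184414247413304024109414512625389910578695200309248 97687410364390065207099941980666471779325561083789376 11853169152 1542377819253323091558600570015318318726314360655606808979400435858362824423937486403719530533592134179618816)
  ∷ (543242106 , certificate 884161929362929964504369408 687184414425819265752546414689951790265250520570003456 97687410387044789136521997182871884807890328980029504 11853169152 1542377819253323091558600570015318318726314360655606808979400435858362824423937486403719530533592134179618816)
  ∷ (431052106 , certificate 882542157498341598903748681 878746128492882567638670377706081256245847252401131520 49036394303301065380313188167240162911252494019469376 12939460648 1579647171763161753622086999346985222929843892333141535982763940917010501251788559166761926805499160033394688)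
  ∷ (432052106 , certificate 882542157498341598903748681 878746128671288529226915362838367002427034144448974848 73361627577337358749425941664505695763054196770742336 12939460648 1579647171763161753622086999346985222929843892333141535982763940917010501251788559166761926805499160033394688)
  ∷ (543052106 , certificate 882537435275973917334390857 687184185709376541383754011881123277807843003131236352 73361627576983380017560953981546347054456455909351488 12939460648 1579647171763161753622086999346985222929843892333141535982763940917010501251788559166761926805499160033394688)
  ∷ (432152106 , certificate 882542157498341598769530953 878746128671288529393068862446265942600559727623540736 122012094125763924240934660922128160525769652459020352 18308169768 1579647171763161753622086999346985222929843892333141535982763940917010501251788559166761926805499160033394688)
  ∷ (543152106 , certificate 882537435275973917200173129 687184185887782502971998997148193480049579595818602496 122012094103109200331308237531772404058645535408529472 18308169768 1579647171763161753622086999346985222929843892333141535982763940917010501251788559166761926805499160033394688)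
  ∷ (543252106 , certificate 882537435293983917663144009 687184186066188464700435997325519880404251421188296704 122012094125763924261379329802609044313108481755324480 18308169768 1579647171763161753622086999346985222929843892333141535982763940917010501251788559166761926805499160033394688)
  ∷ (521043106 , certificate 884161929216562692207462656 304060529387753012605957771895821173634159536606019584 49036761195869026453277279766709645987946072086151232 11853201920 1542377819253323091558600570015318318726314374025331337214199528367487432702451538032955856261977175331176448)
  ∷ (532043106 , certificate 884161929216567090253973760 495622471995989119568444151498123358271222696171274240 73362085768802183853802481021105887998802831327100992 11853201920 1542377819253323091558600570015318318726314374025331337214199528367487432702451538032955856261977175331176448)
  ∷ (542043106 , certificate 884161929216567090253973760 495622471460771235468323193993724056179565550167916544 73362085746147459943851539077091704804895558256033856 11853201920 1542377819253323091558600570015318318726314374025331337214199528367487432702451538032955856261977175331176448)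
  ∷ (532143106 , certificate 884161929216567090119756032 495622471995989119734597651106637534054936256707035136 73362085791456907805291797833398692256982872050892864 11853201920 1542377819253323091558600570015318318726314374025331337214199528367487432702451538032955856261977175331176448)
  ∷ (542143106 , certificate 884161929216567090119756032 495622471639177197056568179261409494031490120216477696 73362085768802183895340855889384509063075598979825728 11853201920 1542377819253323091558600570015318318726314374025331337214199528367487432702451538032955856261977175331176448)
  ∷ (543243106 , certificate 884161929360677880149100800 687184414425819265752683855744830401741083067118256128 97687410387044789136537128523976867317371090065686592 11853201920 1542377819253323091558600570015318318726314374025331337214199528367487432702451538032955856261977175331176448)
  ∷ (421053106 , certificate 873211385219055330782464274 875367136710508797414617134547152032436367432614412288 121982864093016879542571430233920378472887258678820928 9699330584 368106527866406477613607693836174621716189671348496801255966754662903170434798068719852228273037435209908224)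
  ∷ (432053106 , certificate 873210720974144115611650898 1031011215790188437986459328868481916305560267999674368 72595800763623220723062136450876655933969394020122688 2216692248 112381432183513504069064285334746344740645611266715936296168121752496611015114367202969471228255415551787008)
  ∷ (542053106 , certificate 873205998607661245966437202 1031011214901294673003391770133532087144293048099799040 72595800696367091486966196992415488043003523327328320 2216692248 112381432183513504069064285334746344740645611266715936296168121752496611015114367202969471228255415551787008)
  ∷ (432153106 , certificate 873210720974144115611650898 1031011215790188438152612828341596400418536150534717440 72595800763977114405753618440676302766603574297493568 2216692248 112381432183513504069064285334746344740645611266715936296168121752496611015114367202969471228255415551787008)
  ∷ (542153106 , certificate 873205998607661245966437202 1031011215079700634591636755265817833325479940147642368 72595800719021730368188302123750853148286065110679616 2216692248 112381432183513504069064285334746344740645611266715936296168121752496611015114367202969471228255415551787008)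
  ∷ (543253106 , certificate 873205998769786434505263954 1031011215258106596346035239254363664161278178336702464 72595800741676369249410407216707619634263295080529984 2216692248 112381432183513504069064285334746344740645611266715936296168121752496611015114367202969471228255415551787008)
  ∷ (321054106 , certificate 873211385197768940287543570 875367137067321283682533236741883595874332122859175936 146302251360857656540726614445764066904125231763554368 9699330592 368106527866406477613607709250417540987721606134266325612501048090203529124869953652445811552835975029850112)
  ∷ (432054106 , certificate 873211385053658150258198802 875367136888915321931055419276267331216215887879602176 146302251360857656519627758647047947050014234158301248 9699330592 368106527866406477613607709250417540987721606134266325612501048090203529124869953652445811552835975029850112)
  ∷ (532054106 , certificate 873205998624936849971465042 1031011215436513120693399357987434912650468747857362944 72595800719021643927515289633052564962783818852597824 2216692256 112381432183513504069127422073743680935450493778687700660633999974765805549555051106286585136742714650525696)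
  ∷ (432154106 , certificate 873211385053658699879794962 875367136888915322097208918879945803721470931716538368 146302251360857656540726614464804648563055641265176640 9699330592 368106527866406477613607709250417540987721606134266325612501048090203529124869953652445811552835975029850112)
  ∷ (532154106 , certificate 873205998624936849971465042 1031011215436513120859552857460549396763444630392406016 72595800741676282808412876210729503341283204615372864 2216692256 112381432183513504069127422073743680935450493778687700660633999974765805549555051106286585136742714650525696)
  ∷ (543254106 , certificate 873205998769047640000809810 1031011215258107159938842536586793028116845136276094976 72595800741676282849621582656402875688035962574864448 2216692256 112381432183513504069127422073743680935450493778687700660633999974765805549555051106286585136742714650525696)
  ∷ (521043206 , certificate 862104428805085709817891200 288720608559139779085288865105185174595926134284615680 72221840460127080075503996841678018879141067423219776 10796237824 405375880376245139677472989844554300903144344434673489784347338548733989112791263620057086765911060439400448)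
  ∷ (531043206 , certificate 862104428660970521742035328 288720608559139778423595534659880593417088611416801280 72221840460127080012866845402845792261123692728156224 10796237824 405375880376245139677472989844554300903144344434673489784347338548733989112791263620057086765911060439400448)
  ∷ (541043206 , certificate 884161929216567090243193216 304060528852535128173529815602689054974892546449211392 24711436532316973288662775229749142550405385553969216 12943721472 1579647171763161753622276409563977231514258555099315905474935347010356769932825580765630258424152611092463616)
  ∷ (532143206 , certificate 862104428660975469410142592 480282551167375885884542412349978324237666577857642496 96167083308811317376534923669817054211899563463147584 10796237824 405375880376245139677472989844554300903144344434673489784347338548734584606933375262368147671474066033770496)
  ∷ (542143206 , certificate 884161929216567090108975488 495622471639177197056568179258118511879244744501493760 49036761150559578591507431815350663956841895764688960 20459914240 1579647171763161753622276409563977231514258555099315905474935347010356769932825580765630258424152611092463616)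
  ∷ (543143206 , certificate 884161929360682278184831360 687184414247413304019054558705678191605635369704357888 73362085746147459901983575033103902275439994872004672 20459914240 1579647171763161753622276409563977231514258555099315905474935347010356769932825580765630258424152611092463616)
  ∷ (421053206 , certificate 883222517380184963443706147 875378828723558443977252913947097702899879549241659392 122012094125747164047333440108779684834753242108268544 9680619024 330837175356567815549931823459029870385181676032912550428170947588705599121828449809632639566347478472130560)
  ∷ (431053206 , certificate 883222517236069775367850275 875378828723558443314910546394476268267475714332692480 122012094125747164026564252694290141255851850525577216 9680619024 330837175356567815549931823459029870385181676032912550428170947588705599121828449809632639566347478472130560)
  ∷ (541053206 , certificate 883217794869586905722636579 304060300495293704836530000733966299944523364724903936 97686860874360065020802869332594326450834375000461312 9680619024 330837175356567815549931823459029870385181676032912550428170947588705599121828449809632639566347478472130560)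
  ∷ (432153206 , certificate 861461262169186709376457579 109131059001101818359055474221434202736928870348886016 98446841748072879715381184045686347926015524070756352 1224902160 41856349741818805086905269326212498921541472222291153613510090998417830827218980638034456459530132227424256)
  ∷ (542153206 , certificate 861456539802703839731243883 109131058290614014798079401145655635643872659961810944 98066851299717650635484267829205870775931037058338816 1224902160 41856349741818805086905269326212498921541472222291153613510090998417830827218980638034456459530132227424256)
  ∷ (543153206 , certificate 861456539946819027807099755 109131058290614014966504530184894097022985565916106752 98066851299717650635484267848855637711151630792527872 1224902160 41856349741818805086905269326212498921541472222291153613510090998417830827218980638034456459530132227424256)
  ∷ (321054206 , certificate 883222517368609442465433891 875378829080409041870136683136253041140261892397731840 146337327400126375621739019601624033968115848313311232 9680619536 330837175356567815549931823459029870385181676032912550428170947591537439615764614411169240240483371826905088)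
  ∷ (431054206 , certificate 883222517224494254389578019 875378828723597118530413880845720419937978233039360000 122012094125741633108569635981357710442652596169084928 9680619536 330837175356567815549931823459029870385181676032912550428170947591537439615764614411169240240483371826905088)
  ∷ (531054206 , certificate 883222517224494254389578019 304060301384923043322554976048075776882985898990899200 97686860896655279280245169753750109734157747078303744 9680619536 330837175356567815549931823459029870385181676032912550428170947591537439615764614411169240240483371826905088)
  ∷ (432154206 , certificate 883222517224499202057685283 875378828902003080284812365274315248987400701255094272 146337327400126375642508207035158881590444917552320512 9680619536 330837175356567815549931823459029870385181676032912550428170947591537439615764614411169240240483371826905088)
  ∷ (532154206 , certificate 861456539829408846866144107 109131058647464612690963170334810973884255003117883392 98446841748067348798370264178881256193157117667446784 1224902672 41856349741818805086905269326212498921541472222291153613510091001249671321155145239571656506481433253085184)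
  ∷ (543154206 , certificate 861456539973524034941999979 109131058290652690182007864636138248693488084622774272 98066851299712119717819240291977824175858649624219648 1224902672 41856349741818805086905269326212498921541472222291153613510091001249671321155145239571656506481433253085184)
  ∷ (321054306 , certificate 706714035062846453075004267 112498358776686936193915631453360951354369787071827968 24711161073501051762824482347724333503076588283498496 1141016600 112381432183513504068938027270994591622567780424985322524975241239697908450947938020318310294416337934581760)
  ∷ (421054306 , certificate 883222517224494781599172899 875378828723597118862721414115188643379703053405392896 73361627576972148103988743116905374339635028974637056 11828103192 1542377819253323091558411098141354633055772014073028818407018130219948643443947398177473654829394564848123904)
  ∷ (521054306 , certificate 883222517224494781599172899 304060301384923043654862509317544000324710719356932096 49036394347885794275664276889297773631140179883855872 11828103192 1542377819253323091558411098141354633055772014073028818407018130219948643443947398177473654829394564848123904)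
  ∷ (432154306 , certificate 883222517224499179511466275 875378828902003080284812900064502102029324275281301504 97686860851356890616828537562071776615821924312289280 11828103192 1542377819253323091558411098141354633055772014073028818407018130219948643443947398177473654829394564848123904)
  ∷ (532154306 , certificate 883222517224499179511466275 495622243993159150783502388528360360745487439457947648 73361627622270536788504071334464175907327075221508096 11828103192 1542377819253323091558411098141354633055772014073028818407018130219948643443947398177473654829394564848123904)
  ∷ (542154306 , certificate 861456539973523385332915051 109131058290652689683547901313746576123696164125544448 97306870403001661536936692025670418606023022704332800 1258457112 116395054761496129214256963837773243768961769156029814491516021708625023484102786434440842762359057886052352)
  ∷ (521043216 , certificate 886887408107185607899367715 303805269349219913771067060176946094016365913038131200 73332307672941569408156804044876773904881175314829312 10754294792 368106527866406477613797073224680791757540489431841299740940052772194698925993960825951368892392917155479552)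
  ∷ (531043216 , certificate 886887407963070419823511843 303805269349219913109373729731641512837528390170316800 73332307672941569387058027474323168315107771253526528 10754294792 368106527866406477613797073224680791757540489431841299740940052772194698925993960825951368892392917155479552)
  ∷ (541043216 , certificate 886882685596587550178298147 303805268459629249838852088868776187569568374610989056 73332307672941569408156804084166863042356623492780032 10754294792 368106527866406477613797073224680791757540489431841299740940052772194698925993960825951368892392917155479552)
  ∷ (532043216 , certificate 886887407963074817870022947 495367211957456020404167107818060771152851312774221824 97651694940782517876687472430189985242543613565997056 10754294792 368106527866406477613797073224680791757540489431841299740940052772194698925993960825951368892392917155479552)
  ∷ (542043216 , certificate 886882685596591948224809251 495367211067865357133645466955195445884891297214894080 97651694918481772699255625879155148583310037503971328 10754294792 368106527866406477613797073224680791757540489431841299740940052772194698925993960825951368892392917155479552)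
  ∷ (543043216 , certificate 886882012454815193827920747 1030767874878679864736774766707526106612001975791259648 96903406011850199880785444931754594441559998938484736 1140950024 112381432183513504068938058099480430165631690719049234741483495901226887283014005286250374869748728094294016)
  ∷ (421053216 , certificate 884167369976991371923310883 875379011411121552872568053228767569159724188144504832 97687410341707779754691813596626017049088457471168512 10754294792 1505108466743484429494924668809687728852242478693713756330795940891861864066381458948598455116162703256748032)
  ∷ (431053216 , certificate 884167369832876183847455011 875379011411121552210874722783462987980886665276690432 97687410341707779754362224460211721973437038726746112 10754294792 1505108466743484429494924668809687728852242478693713756330795940891861864066381458948598455116162703256748032)
  ∷ (541053216 , certificate 884162647466393314202241315 304060483182856813732494177122953019657934315668901888 73362085768769092765704147112145771224502313379434496 10754294792 1505108466743484429494924668809687728852242478693713756330795940891861864066381458948598455116162703256748032)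
  ∷ (432053216 , certificate 884167369832880581893966115 875379011589527513799119707608379344525054089655488512 122012734959944855448634406635680168963269467031736320 10754294792 1505108466743484429494924668809687728852242478693713756330795940891861864066381458948598455116162703256748032)
  ∷ (542053216 , certificate 884162647466397712248752419 495622425791092921027287555209372277973257238272806912 97687410364705423261445706126735686827852313383145472 10754294792 1505108466743484429494924668809687728852242478693713756330795940891861864066381458948598455116162703256748032)
  ∷ (543053216 , certificate 884162057314702541618956579 687184368396889883985956277626435475601059041079988224 122012734959944855448963995792041740062562267158810624 10754294792 1505108466743484429494924668809687728852242478693713756330795940891861864066381458948598455116162703256748032)
  ∷ (321054216 , certificate 884166632100156364751391011 878746311537398955298695214181459878329989128704757760 122012734960685223458774842510104246030073564647395328 10754327560 1505108466743484429494924668809687728852242478696977849233197014889056474566490644129479097402832652647563264)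
  ∷ (431054216 , certificate 884166631956041176675535139 878746311180587031958972411890927257127705469346385920 97687410342442703267076594180660687174930647845703680 10754327560 1505108466743484429494924668809687728852242478696977849233197014889056474566490644129479097402832652647563264)
  ∷ (531054216 , certificate 884166631956041176675535139 304060484069502556427572217238704297995425866718908416 73362085769155567113592699236164546100736939610607616 10754327560 1505108466743484429494924668809687728852242478696977849233197014889056474566490644129479097402832652647563264)
  ∷ (432054216 , certificate 884166631956045574722046243 878746311358992993547217396715843613671872893725184000 122012734960331329817621735369542638566752945502162944 10754327560 1505108466743484429494924668809687728852242478696977849233197014889056474566490644129479097402832652647563264)
  ∷ (532054216 , certificate 884166631956045574722046243 495622426677738663722365595325123556310748789322813440 97687410387044193664137840425046497492559237267066880 10754327560 1505108466743484429494924668809687728852242478696977849233197014889056474566490644129479097402832652647563264)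
  ∷ (543054216 , certificate 884161909733677893152688419 687184368397081005704056045758599889052681752407445504 122012734959977436156348477921501387156710719876501504 10754327560 1505108466743484429494924668809687728852242478696977849233197014889056474566490644129479097402832652647563264)
  ∷ (321054316 , certificate 707357172715835226855590763 112498541461266449298968366860714918577095807395696640 24711436533732207695188747623750190295087921794387968 1140983304 112381432183513504068938073513723349437163638877808177132899206099884651752211710619880075094106196223787008)
  ∷ (421054316 , certificate 884166631956041991647676707 878746311180587032291315439377120926679716342308278272 73362085724907970399217783853535394454000114315300864 11828069896 1505108466743484429494924668809687728852242478696977849233197014891888315060426808731016297449783953673224192)
  ∷ (521054316 , certificate 884166631956041991647676707 304060484069502556759915244724897967547436739680800768 49036761151620834245733888909039253379806406080204800 11828069896 1505108466743484429494924668809687728852242478696977849233197014891888315060426808731016297449783953673224192)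
  ∷ (432054316 , certificate 884166631956046389694187811 878746311358992993547253425717920209545624003648425984 97687410342442703267071443052617699013188231694389248 11828069896 1505108466743484429494924668809687728852242478696977849233197014891888315060426808731016297449783953673224192)
  ∷ (532054316 , certificate 884166631956046389694187811 495622426677738663722401624327200152184499899246055424 73362085769155567113587548108121557938994523459293184 11828069896 1505108466743484429494924668809687728852242478696977849233197014891888315060426808731016297449783953673224192)
  ∷ (542054316 , certificate 884161909589563520048974115 495622425788844898739334065437507818112560144983789568 73362085768801673473083478093917385588170625856835584 11828069896 1505108466743484429494924668809687728852242478696977849233197014891888315060426808731016297449783953673224192)
  ∷ (321054326 , certificate 862104399992990630862506419 863406390351973798272186034167108418737254300982968320 144057568960869748727169650787517016874844800218562560 9714140688 405375880376245139677283579627562292318729698756027855054842058553833243706956328754142059162412051779878912)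
  ∷ (421054326 , certificate 862104399992990630862506419 863406389998297917887699931201158839095899340329189376 120112326112185596476285785332553545257329742326005760 9714140688 405375880376245139677283579627562292318729698756027855054842058553833243706956328754142059162412051779878912)
  ∷ (521054326 , certificate 862104399992990630862506419 288720562887213442356299736548935879963619737701711872 96167083308810721945658718164665329368569485325238272 9714140688 405375880376245139677283579627562292318729698756027855054842058553833243706956328754142059162412051779878912)
  ∷ (431054326 , certificate 884166631956046389674363315 878746311180587031959008440588355053546766611532218368 49036761105957662800598196598847315858869680382935040 12935366160 1579647171763161753622276363321248473699662775630716510111202945599263667223374449925885483705661578306191360)
  ∷ (531054326 , certificate 884166631956046389674363315 304060484069502556427608245936132094414487008904740864 24711436532670526647114301654351174784675972147838976 12935366160 1579647171763161753622276363321248473699662775630716510111202945599263667223374449925885483705661578306191360)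
  ∷ (541054326 , certificate 884161909589563520029149619 304060483180608791444540687046439760342547254642475008 24711436532316633006610231640147002433852074545381376 12935366160 1579647171763161753622276363321248473699662775630716510111202945599263667223374449925885483705661578306191360)
  ∷ (654032107 , certificate 28972223540978552393810594547968 946811605654845770551416100470128493609926013004799722375348224 131010179627791269254934813742470535452109576471298928946708544 11851072000 1835945642100052245044848765938739864071547626992084143025661067835456831400956736637142236194966400789381120)
  ∷ (654132107 , certificate 28249266558035910860324179598144 120443716586221964497416086873249328433634000907716314888929280 78771942802154693858984830633018878640394699702356983880613952 2338390528 116395054761496129214446435711736929439504194700278410150598143219655465102147558431475101498535186641453056)
  ∷ (654232107 , certificate 28249266558035910855926133087040 120443716777783907105652194168042706517937639038713636437098496 79180052518988830771055765582373471102843296995299546856947776 2338390528 116395054761496129214446435711736929439504194700278410150598143219655465102147558431475101498535186641453056)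
  ∷ (654332107 , certificate 28249266558626062551096762882880 120443716969345849711449157126711428935000836666515439244279808 79588162235822967682778251346462647787798030117324275732185152 2338390528 116395054761496129214446435711736929439504194700278410150598143219655465102147558431475101498535186641453056)
  ∷ (653042107 , certificate 28972242878903282953809660528896 741123535992314026570708128474266422233028962332768466173952000 104891059695385421724937291520209633902721742945592041491660864 11853169152 1835945642100052245044848781352982783343079561781118557182277685522158147097704225739999010016802934412541952)
  ∷ (653142107 , certificate 28249266553820831211672058518336 120443716586221964313628357941663741629444623568959023578873856 78771941269659151544283223497106746108373784280308384214024256 2340487680 116395054761496129214509572450734265634309090581975499647544364213255614421668712953410490017960163633266688)
  ∷ (653242107 , certificate 28249266553820831207274012007232 120443716777783906921864465236457119713748261699956345127043072 79180050986493288478306454501264920745114417361723244843106368 2340487680 116395054761496129214509572450734265634309090581975499647544364213255614421668712953410490017960163633266688)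
  ∷ (654342107 , certificate 28249266558543053574955581365056 120443716969345849711642575750696484102252166851155365288476672 79588160703327425389674961554258297181249112289272218173833280 2340487680 116395054761496129214509572450734265634309090581975499647544364213255614421668712953410490017960163633266688)
  ∷ (643052107 , certificate 28972372838556865813457301457152 741123537135954539672889036420885199645186949749181635900211200 104891058210441936088283130998887007380593045451955894483157056 11855266304 1835945642100052245044848796767225702614611496570152971338894303208859462794451714842855783838639468035702784)
  ∷ (643152107 , certificate 28972372838556865813457167239424 741123537135954539851294998009130184912872387601106205948772352 104891058210822017880490693281634535849181964438225610634166336 11855266304 1835945642100052245044848796767225702614611496570152971338894303208859462794451714842855783838639468035702784)
  ∷ (643252107 , certificate 28972372838556883823457630210304 741123537135954540029700959737567185090198787955778031318466560 104891058211202099672698255562759471588164375982218883253928000 11855266304 1835945642100052245044848796767225702614611496570152971338894303208859462794451714842855783838639468035702784)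
  ∷ (654352107 , certificate 28972218101364491328963542829312 946811606229786767578149321535428819091035283489015961531973632 131010176635805936550589331110612110231561025541545566578933824 11855266304 1835945642100052245044848796767225702614611496570152971338894303208859462794451714842855783838639468035702784)
  ∷ (543062107 , certificate 28919141416905642032399777351753 1152499418432319402589518845799463720581273988621966072260595712 104890468151388139558548896814170788006031605124548421121744960 12939460656 1873214994609890907108272089359895270623336145732451044177709605788624581231002827425010449186657228481036288)
  ∷ (543162107 , certificate 28919141416905642032399643134025 1152499418432319402767924807387708705848344190863702664947961856 157128508841546664319456925542089235894825995482774615638417472 18308169776 1873214994609890907108272089359895270623336145732451044177709605788624581231002827425010449186657228481036288)
  ∷ (543262107 , certificate 28919141416905660042400106104905 1152499418432319402946330769116145706025670591218374490317656064 157128508841926746111664487823863208702439634252666066708734016 18308169776 1873214994609890907108272089359895270623336145732451044177709605788624581231002827425010449186657228481036288)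
  ∷ (654362107 , certificate 28918986679713267547906018723913 946811348770535947780745157159049848962189064200244625512861696 157128508841926746133616783878666790857388856927304297566183488 18308169776 1873214994609890907108272089359895270623336145732451044177709605788624581231002827425010449186657228481036288)
  ∷ (652043107 , certificate 28972242878903154600935738886400 535435466327163271301336980981849752252759731201824798544494592 78771941294352683230572925689228085003106618519433563039072320 11853201920 1835945642100052245044848781352982783343079575150843085417076778031282755376218277369235335745187975564099584)
  ∷ (652143107 , certificate 28249266558543175176327744772928 120443716586221963959952476391319916887873940803574630630031360 78771941269659151611539437844698884864524914263053577159442496 2340520448 116395054761496129214509572450734265634309090585239592549945438210450224921777898134291132304630113024081920)
  ∷ (653243107 , certificate 28249266558543175171929698261824 120443716777783906568188584350727292400408000654457879231201280 79180050986493288500607199698837119566779837963502899373015104 2340520448 116395054761496129214509572450734265634309090585239592549945438210450224921777898134291132304630113024081920)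
  ∷ (654243107 , certificate 28249266558543175171929698261824 120443716777783907103406468783155248851036270972066790304645120 79180050986493288477952475788886177622765654769595626301947968 2340520448 116395054761496129214509572450734265634309090585239592549945438210450224921777898134291132304630113024081920)
  ∷ (642053107 , certificate 28972372838556737460583379814656 535435467470803784403517888928468529664917718618237968270753792 78771939785838099187045876482852034598917085949988788458750016 11855299072 1835945642100052245044848796767225702614611509939877499573693395717984071072965766472092109567024509187260416)
  ∷ (642153107 , certificate 28972372838556737460583245596928 535435467470803784581923850516713514932603156470162538319314944 78771939786218180979253438786044231947986888723597333906063424 11855299072 1835945642100052245044848796767225702614611509939877499573693395717984071072965766472092109567024509187260416)
  ∷ (643253107 , certificate 28972372838556881571373274941696 741123537135954540029700959737704626145077399431610577866719232 104891058211202099672698169162954876909737619744240726117187648 11855299072 1835945642100052245044848796767225702614611509939877499573693395717984071072965766472092109567024509187260416)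
  ∷ (654253107 , certificate 28972218100774337381708557764864 946811606038224824819383184296075487585734322270983574860070912 131010176611480611956395159892162786545169771320521891661480000 11855299072 1835945642100052245044848796767225702614611509939877499573693395717984071072965766472092109567024509187260416)
  ∷ (542063107 , certificate 28613368904880592994672898591570 1312778934718367914943341343277967427682525443437176492537675776 77949147526673482639035449481996013813002596438301582089781312 2216692760 112381432183513504069064285334746344740645611266715936296168121752540858359234837737114221233011012069916672)
  ∷ (542163107 , certificate 28613368904880592994672898591570 1312778934718367915121747304866212412814811189618363384585519104 77949147527053473087390678604080341985428781134975758042923072 2216692760 112381432183513504069064285334746344740645611266715936296168121752540858359234837737114221233011012069916672)
  ∷ (543263107 , certificate 28613368904880755119861437418322 1312778934718367915300153266620610896803357020454161622774579200 77949147527433463535745907747258376087931291339415696724721728 2216692760 112381432183513504069064285334746344740645611266715936296168121752540858359234837737114221233011012069916672)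
  ∷ (654263107 , certificate 28613214167098210930196720241490 1312778933955487445355682227957894401044914714519921930457841664 77949147503108230306659553918933909860323690630920847633940544 2216692760 112381432183513504069064285334746344740645611266715936296168121752540858359234837737114221233011012069916672)
  ∷ (632054107 , certificate 28972218096568326298254281328896 535435467091047199491729038187100419489203993952029137797906432 78771939810163423804607745540569392982494794701805542382501952 11855331840 1835945642100052245044848796767225702614611523309602027808492488227108679351479818101328435295409550338818048)
  ∷ (632154107 , certificate 28972218096568326298254147111168 535435467091047199491729038353253919097718169735742698333667328 78771939834488748422496372111883721644201682871446755965403200 11855331840 1835945642100052245044848796767225702614611523309602027808492488227108679351479818101328435295409550338818048)
  ∷ (643254107 , certificate 28972218096568470409044176455936 741123536756197954582694224896215558464964372673744601390514176 104891058235147342497704026815291371825937651188711571597819968 11855331840 1835945642100052245044848796767225702614611523309602027808492488227108679351479818101328435295409550338818048)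
  ∷ (653254107 , certificate 28972218096568470409044176455936 741123536373074069901439895071363757074244315312620496988143616 104891058210822017924416890661807476881441510114517863362723904 11855331840 1835945642100052245044848796767225702614611523309602027808492488227108679351479818101328435295409550338818048)
  ∷ (532064107 , certificate 28613368904880610270276903619410 1312778934718367915478559790967975015536428268943352192295239680 77949147527053380316290566276344729090359536487557218800238656 2216692768 112381432183513504069127422073743680935450493778687700660633999974810052893675521640431335141498311168655360)
  ∷ (532164107 , certificate 28613368904880610270276903619410 1312778934718367915478559791134128515009542753056328074830282752 77949147527433370764645795398104538709127294457448238732804160 2216692768 112381432183513504069127422073743680935450493778687700660633999974810052893675521640431335141498311168655360)
  ∷ (543264107 , certificate 28613368904880754381066932964178 1312778934718367915300153830213418194135786384409728580713971712 77949147527433370764645795460082432569597164204488915213877312 2216692768 112381432183513504069127422073743680935450493778687700660633999974810052893675521640431335141498311168655360)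
  ∷ (653264107 , certificate 28613214162375843708532570573650 1312778933955487445174837686288674425285181831334182846879760384 77949147503108137535559441610659110523326167618241687135191104 2216692768 112381432183513504069127422073743680935450493778687700660633999974810052893675521640431335141498311168655360)
  ∷ (432065107 , certificate 28613390670160492634869935229202 1148871253824194915482906765251565914397337260895716579354345472 183203589475047607589998503979224101102645489451464901808881728 9699331112 368106527866406477613607724664660460259253540920035849969035341520335047744144795134949782245071700690632704)
  ∷ (432165107 , certificate 28613390670160492635419556825362 1148871253824194915482906765417719414001015733400971623191281664 183203589475047607590352482732507313326456539217943625440952384 9699331112 368106527866406477613607724664660460259253540920035849969035341520335047744144795134949782245071700690632704)
  ∷ (543265107 , certificate 28613390665438288277738450438418 1148871253632632972877806700725086548880269671204663316756037632 183203589475047607590352482752951982206937423005282454737256512 9699331112 368106527866406477613607724664660460259253540920035849969035341520335047744144795134949782245071700690632704)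
  ∷ (643265107 , certificate 28613214162941930700569322834770 1312778934338611923588186899667285496693288870813888387389849600 77949147527433277994281378945935655828942245522590401435009088 2216692776 112381432183513504069190558812741017130255376290659465025099878197079247428116205543748449049985610267394048)
  ∷ (651043207 , certificate 28972242878903154600935728105856 329747396662012516031965833162180939132671394745296702180163584 26533704468341963393159956583745223239874151851083558855639104 12943721472 1873214994609890907108524620901641696131023756224827653677812596674152092606592320101909737907363411325386752)
  ∷ (652143207 , certificate 28972242878903154600935593888128 535435466518725213909573088276643130778657088672659491103178752 52652822893319944736208559817661514933032415961471384199102528 20459914240 1873214994609890907108524620901641696131023756224827653677812596674152092606592320101909737907363411325386752)
  ∷ (653143207 , certificate 28249266558543175171929723132800 120443716586221963959952477055933914009372999449784875512496128 52652822844681170245836110658963687144679038201634781770285120 3431040000 153664407271334791278185411999393178422253271659224160810681256853319562152151940866966133839620956456255488)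
  ∷ (654143207 , certificate 28249266558543175171929723132800 120443716586221964495170361488361870460001269767393786585939968 52652822844681170223181386749012745200664855007727508699217984 3431040000 153664407271334791278185411999393178422253271659224160810681256853319562152151940866966133839620956456255488)
  ∷ (641053207 , certificate 28249437919100558886237317908864 310062406766847698033607249810171718717027031313702645632335872 77547610708293850165833245811510776537920268297624283462500416 10798334976 405375880376245139677536141997794556369481175102140103637827852969634497122384303074586058562882227547439104)
  ∷ (642153207 , certificate 28249437919100558891184986016128 515750476431998453481384359218085516795349359454346714231603200 103258619440763019192741715004340336962378732095615620196859968 10798334976 405375880376245139677536141997794556369481175102140103637827852969635092616526414716897119468445233141809152)
  ∷ (643153207 , certificate 28249437918510407196014356220288 721438546097149208748316362701629673941465892334003609684410368 128969628173232188195955642402632333729006352548951983357165632 10798334976 405375880376245139677536141997794556369481175102140103637827852969635092616526414716897119468445233141809152)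
  ∷ (654153207 , certificate 28972218100774337386106593495424 946811605846662882211147076855897797285079210364380379221065728 104891058162171368667014098956873431032673572275419953340874816 20462011392 1873214994609890907108524636315884615402555691013862067834429214360853408303339809204766511729199944948547584)
  ∷ (541063207 , certificate 28941435444791545969849595709731 1148883807452926652874455534255661114722803109466341208748462080 131009488496645384042365165558218720821368636701757541366370304 9680651792 330837175356567815549931823459029870385181689402687307736817460471051760582504379972671253088201209368608768)
  ∷ (542163207 , certificate 28228362638759739277700058176363 120443460081615289972336748887626719883014416858757431030190080 105706491425621061128180873808126373574214069027404449090899968 1224934928 41856349741818805086905269326212498921541472431243328441026247192094456013773196144230550900310542005633024)
  ∷ (543163207 , certificate 28228362638759883392888134032235 120443460081615289972336749056051848922252878237870336984485888 105706491425621061128180873828895561028003146476747028141969408 1224934928 41856349741818805086905269326212498921541472431243328441026247192094456013773196144230550900310542005633024)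
  ∷ (654163207 , certificate 28228207900977339203223416855403 120443459127172877598035564686786959902307670532475146442641408 105298479788501539655994517300059929776338184523223796558598144 1224934928 41856349741818805086905269326212498921541472431243328441026247192094456013773196144230550900310542005633024)
  ∷ (631054207 , certificate 28249437923085048534099791202688 310062406766847698920252992505249758832778309651194196682342400 77547610708293850232065719288078746300757709045547759308898368 10798367744 405375880376245139677536141997794556369481175105404196540228926966829107622493488255466700849552176938254336)
  ∷ (632154207 , certificate 28249437923085048539047459309952 515750476431998454189624140491072071251929375723627255768809472 103258619440763019258979632998773971157875718488389741610795072 10798367744 405375880376245139677536141997794556369481175105404196540228926966829798821051296411720610829223522717433856)
  ∷ (643154207 , certificate 28249437918362826171365889952128 721438546097149208748507484419729442073630305785626321011867648 128969628173232188195982778592151151445451498566987514596294720 10798367744 405375880376245139677536141997794556369481175105404196540228926966829798821051296411720610829223522717433856)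
  ∷ (653154207 , certificate 28972218096568470413442212186496 741123536181512127293203787631186066773589203406017301349138432 78771939761512774613078089153843723732478120851340917450211392 20462044160 1873214994609890907108524636315884615402555704383586596069228306869978016581853860834002837457584986100105216)
  ∷ (531064207 , certificate 28941435449513900877198262651171 1148883807452926653764084872741686090036912586404803743014457344 131009488496639445287011030318595937714605540635818424835510272 9680652304 330837175356567815549931823459029870385181689402687307736817460473883601076440544574207853762337102723383296)
  ∷ (532164207 , certificate 28228362638759765982707193076587 120443460081615290329187346780510489072169755099139774186262528 106114503038789401041981225173112559129740980345085852792655872 1224935440 41856349741818805086905269326212498921541472431243328441026247194926296507709360745767750947261843031293952)
  ∷ (543164207 , certificate 28228362638759910097895268932459 120443460081615289972375424271555183373497029908372855691153408 105706491425615122350525993412495039099261070870097831553142784 1224935440 41856349741818805086905269326212498921541472431243328441026247194926296507709360745767750947261843031293952)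
  ∷ (653164207 , certificate 28228207896254999425360906541931 120443459127172877417229134640263021261389575061671623631835136 105298479788495600878339636862236112684093987462542591709941760 1224935440 41856349741818805086905269326212498921541472431243328441026247194926296507709360745767750947261843031293952)
  ∷ (431065207 , certificate 28941435449134594205782237366563 1148883808027653996652929062383497490193812500067401884909441024 157128508841896872390595275358839350120686863423273596868890624 9680652816 330837175356567815549931823459029870385181689402687307736817460476715441570376709175744454436472996078157824)
  ∷ (432165207 , certificate 28941435449134594210729905473827 1148883808027653996831335024137895974622407329116824353125175296 183247529187160238316756858588937870805573571519515063608676352 9680652816 330837175356567815549931823459029870385181689402687307736817460476715441570376709175744454436472996078157824)
  ∷ (543165207 , certificate 28941435444412371843048336116003 1148883807836092054047828997716826109324334866565844221320237056 183247529187160238316402964927664613357230088654569180689338368 9680652816 330837175356567815549931823459029870385181689402687307736817460476715441570376709175744454436472996078157824)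
  ∷ (643165207 , certificate 28228207897130069099157317081963 120443459701900220306073324282074421418289488724269765526818816 105706491425609183573606382086613628849421059023596130505592832 1224935952 41856349741818805086905269326212498921541472431243328441026247197758137001645525347304950994213144056954880)
  ∷ (621054307 , certificate 28249437923085048534914763344256 310062406766847698920252992837592786318971979203205069644234752 51836601975824681205859592942761334333881706273797654446080064 11872110080 405375880376245139677536141997794556369481175105404196540228926969660948116429652857003900896503477963915264)
  ∷ (632154307 , certificate 28249437923085048539312675637632 515750476431998454189624140491108100258841674875836882390876160 77547610708293850232419612970765077201804531811827169567440960 11872110080 405375880376245139677536141997794556369481175105404196540228926969660948116429652857003900896503477963915264)
  ∷ (642154307 , certificate 28249437918362682056443030423936 515750476431998453479136336930132027028320602872108137641410560 77547610708293850187464228933199760904528922915706548953022528 11872110080 405375880376245139677536141997794556369481175105404196540228926969660948116429652857003900896503477963915264)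
  ∷ (652154307 , certificate 28972218096568470413088955320704 535435466516361372023832639814473949276396456738937181613064192 26533702960195586463016673346638004612382897023212857354879040 21535786496 1873214994609890907108524636315884615402555704383586596069228306872809857075790025435539438131720879454879744)
  ∷ (521064307 , certificate 28941435449513900877725472246051 1148883807452926653764084873073993623306380809846528563380490240 78771447806112713434698752957426474414011132788128409885085696 11828135960 1835945642100052245044596172740021761477732346056343559554076014543820933043949383773474643149344383623593984)
  ∷ (532164307 , certificate 28941435449513900882123384539427 1148883807644488596372320980202633502517197170267305283481505792 104890468151376079360854891648560554077248570936651529100726272 11828135960 1835945642100052245044596172740021761477732346056343559554076014543820933043949383773474643149344383623593984)
  ∷ (542164307 , certificate 28228362638759910097245659847531 120443460081615289972375423773095220051105357338580935193923584 104890468199266564967615529829941123677219857901735470313246720 1258489880 116395054761496129214256963837773243768961769364981989319032177902301648670657001940636937203139467664261120)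
  ∷ (652164307 , certificate 28228207896254999424711297457003 120443459127172877417229133975649558620625923289576354961952768 104482456514256557843370146455983852663907843960998290195484672 1258489880 116395054761496129214256963837773243768961769364981989319032177902301648670657001940636937203139467664261120)
  ∷ (421065307 , certificate 28941435449134594206309446961443 1148883808027653996652929062715805023463280723509126705275473920 104890468151370140539333703546896948173334704698267977120223232 11828136472 1835945642100052245044596172740021761477732346056343559554076014546652773537885548375011243823480276978368512)
  ∷ (432165307 , certificate 28941435449134594210707359254819 1148883808027653996831335024137896509412594182158747927151382528 131009488496633506465141393094303986849985647248780965687332864 11828136472 1835945642100052245044596172740021761477732346056343559554076014546652773537885548375011243823480276978368512)
  ∷ (542165307 , certificate 28941435444412227727837714041123 1148883807644530111439592890752068634791353052793895077999546368 104890468151370140605882045501984747545052060991764225973555200 11828136472 1835945642100052245044596172740021761477732346056343559554076014546652773537885548375011243823480276978368512)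
  ∷ (642165307 , certificate 28228207897130069098507707997035 120443459701900220306073323617460958777525836952174496856936448 104890468151370140539687597229588430182477164644736224192892928 1258490392 116395054761496129214256963837773243768961769364981989319032177905133489164593166542174137250090768689922048)
  ∷ (321065407 , certificate 23157605500939496684602149948267 124059070684606834002463481808581800515282135269820326782439424 26533407164218817408388214011436146548703859059043376155856896 1141049888 112381432183513504068938042685237510894099715419707021709025690863506732821510203060645188061946588558393344)
  ∷ (432165407 , certificate 23157605500939352574361742199659 124059070684606833824057520223257482653344343116959135639801856 26533407164218817408388213949128584324261642827777806445318144 1141049888 112381432183513504068938042685237510894099715419707021709025690863506732821510203060645188061946588558393344)
  ∷ (532165407 , certificate 28941435444412245003441719068963 1148883807644530111796405377019984736986084616231859768244310016 104890468151370140628536597939917093672127239268721884739932160 11828136480 1835945642100052245044659309479019097672537228568315323918541892768921968072326232278328357731967576077107200)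
  ∷ (632165407 , certificate 28941435444412245003441719068963 535435210014908344541205777447919427048388215164648164459810816 78771447854745549215402102708859309331124287711381754646892544 11828136480 1835945642100052245044659309479019097672537228568315323918541892768921968072326232278328357731967576077107200)
  ∷ (651043217 , certificate 29061374562404987868272757066019 329422299187955412671511407330717263671421996995622953302888448 78739965798837760735475212837136897205661973592107619411562496 10754294792 368106527866406477613797073224680791757540489431841299740940052772194698925993960825951368892392917155479552)
  ∷ (652043217 , certificate 29061374562404987872670803577123 535110368853106167940882555150386076486894590562800968552419328 104852709018420497132542786716930438973069663674154551416983552 10754294792 368106527866406477613797073224680791757540489431841299740940052772194698925993960825951368892392917155479552)
  ∷ (653043217 , certificate 29061374561731846095916406688619 1312466647763392713731867573646641197804503177356637859677212672 104049239923706984610051692595643383236236383439969934637535232 1140950024 112381432183513504068938058099480430165631690719049234741483495901226887283014005286250374869748728094294016)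
  ∷ (654043217 , certificate 29061355223641098744719256603499 1312466647760773702978615700879247467676437845326720470077673472 104049239922958695838640505918213742636336496079100033932726272 1140950024 112381432183513504068938058099480430165631690719049234741483495901226887283014005286250374869748728094294016)
  ∷ (641053217 , certificate 29061526584871768346571143399715 329422300334963271218028829022473693406674406720885344642273280 78739965798873476159398116850469581916947225932945621265158144 10754294792 368106527866406477613860209963678127952345385313538389237886273765794848245515115347886757411817894147293184)
  ∷ (642053217 , certificate 29061526584871768350969189910819 535110370000114026487399976842142506222147000288063359891804160 104852709042407392732891331346755033222522940185266004842516480 10754294792 368106527866406477613860209963678127952345385313538389237886273765794848245515115347886757411817894147293184)
  ∷ (643053217 , certificate 29061526584281616655798560114979 740798439665264781754331980325686663368263533167720255344611328 130965452285941309305339198391090174192228296470936211543298048 10754294792 368106527866406477613860209963678127952345385313538389237886273765794848245515115347886757411817894147293184)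
  ∷ (654053217 , certificate 29061349783602884765899330440043 1312466647761028917701843264772889555930614677415086411135586304 104049239922976599233675773537247615440196271232645491553996800 1140950024 112381432183513504068938073513723349437163625508083648898100113587928202979761494389107148691585261717454848)
  ∷ (541063217 , certificate 28972396375421563622107713128739 1148884003612157119485410843860304289753511828352309135376125952 104891058162141867479506612028618087584765085001398022771838976 10754294792 1798676289590213582981172880147352193469007693188950829666153533326988141525228668903496218433683768127553536)
  ∷ (542063217 , certificate 28972396375421563626505759639843 1148884003803719062093646951155097667839931086667632057980030976 131010176587119848800248940455431281706911743308699337908293632 10754294792 1798676289590213582981172880147352193469007693188950829666153533326988141525228668903496218433683768127553536)
  ∷ (543063217 , certificate 28972396374831411931335129844003 1148884003995281004699443914113766390256994284295433860787212288 157129295012097830120294370574021206479774539247360606816702464 10754294792 1798676289590213582981172880147352193469007693188950829666153533326988141525228668903496218433683768127553536)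
  ∷ (654063217 , certificate 28972222294235753907603617368355 946811544355027150262990887888309300111424021699852081612460032 157129294987778442897757340357699144147859374770237181583167488 10754294792 1798676289590213582981172880147352193469007693188950829666153533326988141525228668903496218433683768127553536)
  ∷ (631054217 , certificate 29061526588856257994433616693539 329422300334963272104674571717551733522425685058376895692279808 78739965798873476181736887253161716195915223483818478353780736 10754327560 368106527866406477613860209963678127952345385316802482140287347762989458745624300528767399698487843538108416)
  ∷ (632054217 , certificate 29061526588856257998831663204643 535110370000114027374045719537220546337898278625554910941810688 104852709042407392777182397804250749675782973524611159583887360 10754327560 368106527866406477613860209963678127952345385316802482140287347762989458745624300528767399698487843538108416)
  ∷ (643054217 , certificate 29061526584134035631150093846819 740798439665264781754523102043786431500427946619342966672068608 130965452285941309305371779098474656321687943565084664260988928 10754327560 368106527866406477613860209963678127952345385316802482140287347762989458745624300528767399698487843538108416)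
  ∷ (653054217 , certificate 29061371841629124958615731456291 740798438518512137931233244245672090019352368982446516390596608 130965452238050823675967391135229229420739067623063280452898816 10754327560 368106527866406477613860209963678127952345385316802482140287347762989458745624300528767399698487843538108416)
  ∷ (531064217 , certificate 28972396379406053269970186422563 1148884003612157120372056586555382329869263106689800686426132480 104891058162141774708793060489114370920195845660448784124481536 10754327560 1798676289590213582981172880147352193469007693192214922568554607324182752025337854084376860720353717518368768)
  ∷ (532064217 , certificate 28972396379406053274368232933667 1148884003803719062980292693850175707955682365005123609030037504 131010176587119756051487684970731147216634539756222396913684480 10754327560 1798676289590213582981172880147352193469007693192214922568554607324182752025337854084376860720353717518368768)
  ∷ (543064217 , certificate 28972396374683830906686663575843 1148884003995281004699635035831866158389158697747056572114669568 157129295012097737349226925394013419820646172124325194655862784 10754327560 1798676289590213582981172880147352193469007693192214922568554607324182752025337854084376860720353717518368768)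
  ∷ (653064217 , certificate 28972241632178920234152301185315 741123474692495406282280618986561941699440054294803610694324224 131010176587868044889801107265500470958906593025659861004193792 10754327560 1798676289590213582981172880147352193469007693192214922568554607324182752025337854084376860720353717518368768)
  ∷ (431065217 , certificate 28972372200657923754960716056867 1152499614783310347847311593198743576617704360992498126485458944 131010176587914720126478019119807683725475608697863881487814656 10754360328 1798676289590213582981172880147352193469007693195479015470955681321377362525447039265257503007023666909184000)
  ∷ (432065217 , certificate 28972372200657923759358762567971 1152499614783310348025717554786988561442620717536665550864257024 157129295012518557050015932454364316704738934340605575546015744 10754360328 1798676289590213582981172880147352193469007693195479015470955681321377362525447039265257503007023666909184000)
  ∷ (543065217 , certificate 28972372195935701391677193210147 1152499614591748405063805566943827210485376992917474409546518528 157129295012138566623961448552228836215606863339171715750563840 10754360328 1798676289590213582981172880147352193469007693195479015470955681321377362525447039265257503007023666909184000)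
  ∷ (643065217 , certificate 28972372195935701391677193210147 741123475836132722349771593188869719421058970366106614528217088 131010176635425215374783307239901170937640791729495847175983104 10754360328 1798676289590213582981172880147352193469007693195479015470955681321377362525447039265257503007023666909184000)
  ∷ (621054317 , certificate 29061526588856257995248588835107 329422300334963272104674572049894761008619354610387768654172160 52627222555339559586645270384759013577804132113917561249730560 11828069896 405375880376245139677536049512337040740289566390787050401023166405858795975998343261442401233478686970281984)
  ∷ (632054317 , certificate 29061526588856257999646635346211 535110370000114027374045719537256575339974874499306020865052672 78739965798873476181736887253156565067872235322076062202466304 11828069896 405375880376245139677536049512337040740289566390787050401023166405858795975998343261442401233478686970281984)
  ∷ (642054317 , certificate 29061526584133891516776990132515 535110370000114026485151954554189016450282540427366266602786816 78739965798873476159082248414121871912132344698603803094028288 11828069896 405375880376245139677536049512337040740289566390787050401023166405858795975998343261442401233478686970281984)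
  ∷ (652054317 , certificate 29061371841628980844242627741987 535110368853361382661862096756074674969206962790469816321314816 78739965798873476181736887295343977043467709803886344877379584 11828069896 405375880376245139677536049512337040740289566390787050401023166405858795975998343261442401233478686970281984)
  ∷ (521064317 , certificate 28972396379406053270785158564131 1148884003612157120372056586887725357355456776241811559388024832 78771939737163793366452329690183925485513810235566935461335040 11828069896 1798676289590213582981172880147352193469007693192214922568554607327014592519274018685914060767305018544029696)
  ∷ (532064317 , certificate 28972396379406053275183205075235 1148884003803719062980292693850211736957758960878874718953279488 104891058162141774708793060489109219792152857498706367973167104 11828069896 1798676289590213582981172880147352193469007693192214922568554607327014592519274018685914060767305018544029696)
  ∷ (542064317 , certificate 28972396374683686792313559861539 1148884003803719062091398928867144178068066626806934964691013632 104891058162141774708439166848605149777948685147882470370709504 11828069896 1798676289590213582981172880147352193469007693192214922568554607327014592519274018685914060767305018544029696)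
  ∷ (652064317 , certificate 28972241632178776119779197471011 535435405027344651012909471496964526649294648102826910625042432 78771939785802567901072375564559732948493347096521062310481920 11828069896 1798676289590213582981172880147352193469007693192214922568554607327014592519274018685914060767305018544029696)
  ∷ (421065317 , certificate 28972372200657923755775688198435 1152499614783310347847311593531086604103898030544508999447351296 104891058163690873628989058791109143614112608576227759211679744 11828102664 1798676289590213582981172880147352193469007693195479015470955681324209203019383203866794703053974967934844928)
  ∷ (432065317 , certificate 28972372200657923760173734709539 1152499614783310348025717554787024590444697313410416660787499008 131010176587914720126472488202112071562485467794943638822719488 11828102664 1798676289590213582981172880147352193469007693195479015470955681324209203019383203866794703053974967934844928)
  ∷ (542065317 , certificate 28972372195935557277304089495843 1152499614400186462455569459979105230164284921977352802122862592 104891058162930892821481581383250391772312960527615002413633536 11828102664 1798676289590213582981172880147352193469007693195479015470955681324209203019383203866794703053974967934844928)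
  ∷ (642065317 , certificate 28972372195935557277304089495843 535435406170981967080400445699272304370913564174129914458935296 78771939786217541572303440070922726494346888917939133839052800 11828102664 1798676289590213582981172880147352193469007693195479015470955681324209203019383203866794703053974967934844928)
  ∷ (321065417 , certificate 23178679835552632823844406578027 124059266840680457076914709541063432294648260371608989986197504 26533702937769848666534031082198236532811790310066158337265664 1141016584 112381432183513504068938088927966268708695587036567119524314916298542416221409415953509775318463664353280000)
  ∷ (432065417 , certificate 23178679835552488713054377233259 124059266840680456898508747789585614829031995713492755006623744 26533702937769848666534030998791897717868692519428998711218176 1141016584 112381432183513504068938088927966268708695587036567119524314916298542416221409415953509775318463664353280000)
  ∷ (532065417 , certificate 28972372195935583982311224396067 1152499614400186462990826019294080485012611522285946154791735296 104891058163310883269831279544488522807817813105027585524895744 11828103176 1798676289590213582981172880147352193469007693195479015470955681327041043513319368468331903100926268960505856)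
  ∷ (632065417 , certificate 28972372195935583982311224396067 535435406170981967615657005014247559219240164482723267127808000 78771939786597532020653138232160857529851741495351716950315008 11828103176 1798676289590213582981172880147352193469007693195479015470955681327041043513319368468331903100926268960505856)
  ∷ (621054327 , certificate 28427679226510180243139452062131 309737309295409652166518557073986890176177966098263653530730496 103245770996628075423760857676121946802679249239472795084128256 9714140688 405375880376245139677283579627562292318729698756027855054842058553833243706956328754142059162412051779878912)
  ∷ (631054327 , certificate 29061526588856257999646615521715 329422300334963272104674571717587762219853481477438037878112256 26514479311805642990138078785595534032130254869816743743717376 12935366160 1873214994609890907108461437919915602121623094244256493949614317040789795362700505358847858503757666185183232)
  ∷ (641054327 , certificate 29061526584133891516776970308019 329422300334963271215780806734520203330161147405498283615846400 26514479311805642967483439946560840876390364246344484635279360 12935366160 1873214994609890907108461437919915602121623094244256493949614317040789795362700505358847858503757666185183232)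
  ∷ (651054327 , certificate 29061371841628980844242607917491 329422299188210627392490948936405861849085569768601833334374400 26514479311805642990138078827782946007725729351627026418630656 12935366160 1873214994609890907108461437919915602121623094244256493949614317040789795362700505358847858503757666185183232)
  ∷ (521064327 , certificate 28249420054314522271798927935923 1132814623172186228553869986619585102378690344465698728144011264 128969628123423574461336245338141798467788356168364062637293568 9714140688 405375880376245139677283595041805211590261633545062269211458676240534559403703817856998832984248585403039744)
  ∷ (531064327 , certificate 28972396379406053275183185250739 1148884003612157120372056586555418358566690903108861828611964928 52652821312185812022696024160492703123268988936485186396225536 12935366160 1873214994609890907108524574658912938316427990125953583446560538034389944682221659880783247023182643176996864)
  ∷ (541064327 , certificate 28972396374683686792313540037043 1148884003612157119483162821572350799676998569036922074349699072 52652821312185812022342130519988633109064816585661288793767936 12935366160 1873214994609890907108524574658912938316427990125953583446560538034389944682221659880783247023182643176996864)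
  ∷ (651064327 , certificate 28972241632178776119779177646515 329747335362193895743538323677295713529173255080958927638102016 26533702935846605214975339235943216279609478534299880733540352 12935366160 1873214994609890907108524574658912938316427990125953583446560538034389944682221659880783247023182643176996864)
  ∷ (421065327 , certificate 28249436978970472677886559373747 1132814623741137716975058600525757730051229062861161453206896640 154680636857050068624738350174992995904746832243445374507810816 9714173456 405375880376245139677283595041805211590261646914786797446257768749659167682217869486235158712633626554597376)
  ∷ (431065327 , certificate 28972372200657923760173714885043 1152499614783310347847311593198779605315132157411559268671291392 78771939737947065427287693685891395445770696956003026368200704 12935398928 1873214994609890907108524574658912938316427990129217676348961612031584555182330845061663889309852592567812096)
  ∷ (541065327 , certificate 28972372195935557277304069671347 1152499614208624519847333352684311851773216864207339911781548032 52652821312963238122296786867029715655598189688674389959114752 12935398928 1873214994609890907108524574658912938316427990129217676348961612031584555182330845061663889309852592567812096)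
  ∷ (641065327 , certificate 28972372195935557277304069671347 329747336505831211811029297879603491250792171152261931471994880 26533702936249886873118645554702050377632118078998521384534016 12935398928 1873214994609890907108524574658912938316427990129217676348961612031584555182330845061663889309852592567812096)
  ∷ (321065427 , certificate 28249436978970461102365581101491 1132814623741137717331909198418641499240384401101543796362969088 180391645589519146307788955226197998725837194721520119701307392 9714173968 405375880376245139677283595041805211590261646914786797446257768752491008176154034087771759386769519909371904)
  ∷ (431065427 , certificate 28249436978970316987177505245619 1132814623741137716975097275078918696949851779899260137004597248 154680636857050068624732819194031638596937002267288211558498304 9714173968 405375880376245139677283595041805211590261646914786797446257768752491008176154034087771759386769519909371904)
  ∷ (531065427 , certificate 28972372195935583982311204571571 1152499614208624520382589911999287106621543464515933264450420736 52652821313343228570646485029246392488371959447841689856638976 12935399440 1873214994609890907108524574658912938316427990129217676348961612034416395676267009663201089356803893593473024)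
  ∷ (631065427 , certificate 28972372195935583982311204571571 329747336505831212346285857194578746099118771460855284140867584 26533702936629877321468343716918727210405887838165821282058240 12935399440 1873214994609890907108524574658912938316427990129217676348961612034416395676267009663201089356803893593473024)
  ∷ (321065437 , certificate 23901615052517899813930466397107 104374275801875126330747997412836652306014283008718618081886208 26125593243355146803520012973833271284669503375784311487725568 3288500248 112381432183513504069316847704978608791397154481039367955962074022406716249404683200037928486303437561102336)
  ∷ (421065437 , certificate 28249436978970316987704714840499 1132814623741137716975097275411226230219320003340984957370630144 103258619392111913258620547234533542452378633273028588221759488 11861657624 405375880376245139677346731780802547785066529426758561810723646974760202710594717991088873295256819008110592)
  ∷ (521065437 , certificate 28249436978970316987704714840499 1132814623169819189636423200203367325421675360285992623322169344 77547610659642835620862799928750474584415784664009053766156288 11861657624 405375880376245139677346731780802547785066529426758561810723646974760202710594717991088873295256819008110592)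
  ∷ (621065437 , certificate 28249436978970316987704714840499 310062345467025881600119145398658964899250667230914643012616192 51836601975824224486576148964131667427912565213296201801138176 11861657624 405375880376245139677346731780802547785066529426758561810723646974760202710594717991088873295256819008110592)
  ∷ (765432108 , certificate 925671966593058900705833081127623488 132831105286006513164638096509866860621852206760444296309901203564134400 85895344605150639987559586349397584035297037933118477543685551689039936 2338390528 116395054761496129214446451125979848711036129486047934507132436646955823792219443364068684776081376757678080)
  ∷ (765342108 , certificate 925671966573720726949505742796020544 132831105080318443502106352529158888625990135383547245637869947362738176 85457138487900471461173517452039460950367449439065149962261525344550976 2340487680 116395054761496129214509587864977184905841025367745024004078657640555973111740597886004073295506353749491712)
  ∷ (764352108 , certificate 925671966435600997022473039252872000 132831105080318443304813268622528776626770159965184920656194629513248768 85457136842395912631458828603939442811548026171754004356431220926840896 2342584832 116395054761496129214572724603974521100645921249442113501024878634156122431261752407939461814931330741305344)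
  ∷ (754362108 , certificate 949366713173831969129311711097309440 1020136870609041942590757535734463734398666460697986219640942649540083712 140671106023900559763759962406018541908674609658186804772880130790129728 11857363456 2129513464946781398531097023519133086502908632484699133698388170559356101164965943281992037143686801891786752)
  ∷ (654372108 , certificate 947622425949164668271900596961364041 1461848346577771788758684846125929002384659806757198131740089475313700864 196760536232953125048199420912472469286868603576097323789956828039749696 18308169784 2166782817456620060594457179372805318316828399131760552372655270660238661210217095683258971567815296928677888)
  ∷ (765243108 , certificate 925671966573720727071102716912917312 132831104874630373836955597259787741133573465403278014506926279733280768 85018934016154861787740744142134113194584592214173078426260971995791424 2340520448 116395054761496129214509587864977184905841025371009116906479731637750583611849783066884715582176303140306944)
  ∷ (764253108 , certificate 925671966435600997144070013369768768 132831104874630373639662513353157629134353489984915689525250961883791360 85018932370650302934454956887161206370711745064801097744622040006262848 2342617600 116395054761496129214572724603974521100645921252706206403425952631350732931370937588820104101601280132120576)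
  ∷ (754263108 , certificate 949366713173831378975364456112244992 1020136870609041942399195592975697597159313129192685258422910262868180992 140671106023492450046925732724589740349219983716006041531245961226223680 11857396224 2129513464946781398531097023519133086502908645854423661933187263068480709443479994911228362872071843043344384)
  ∷ (654273108 , certificate 937602872275131993616663909554572114 1630496293571195942080686158182492200581867233846648871553952941825589248 83697259845351596787719549238604396259010597616384571130909927865057344 2216693272 112381432183513504069064285334746344740645611266715936296168121752585105703355308271258971237766608588046336)
  ∷ (763254108 , certificate 925671966590342764177907540560239424 132831104874630373259905927192527048438344980195003130381565064821342208 85018932370650302982725524330404139696551234761015891892471462065602624 2342650368 116395054761496129214572724603974521100645921255970299305827026628545343431480122769700746388271229522935808)
  ∷ (753264108 , certificate 949366713173827173108391791730936064 799280987511743901201283405734260641275834724694584864903543892753252352 112625916164986319735192735225747851999507282819880939738672765170090048 11857428992 2129513464946781398531097023519133086502908659224148190167986355577605317721994046540464688600456884194902016)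
  ∷ (653274108 , certificate 937602872275127271249442245404904274 1630496293571195942080686158001647658912647258086915988368213858247507968 83697259845351497175509300162427745459653560198313025656023879799537728 2216693280 112381432183513504069127422073743680935450493778687700660633999974854300237795992174576085146253907686785024)
  ∷ (743265108 , certificate 949361642588350916141191892549552384 799280987103983372850573180240943206573309951935839251026690868750319616 112625916216816446867221264936694542008642702542839907737551634440650816 11857461760 2129513464946781398531097023519133086502908672593872718402785448086729926000508098169701014328841925346459648)
  ∷ (643275108 , certificate 937602872275127837336434282157165394 1630496293571195942463810636414996872291258329495023027847919398757597184 83697259845759409200418572581827870935393380717602304567578507203575872 2216693288 112381432183513504069190558812741017130255376290659465025099878197123494772236676077893199054741206785523712)
  ∷ (543276108 , certificate 937603585479819022677428115382585618 1457952634493671944110725994985500397136973469517071844555644673511129088 224751700886240506392624320006436812145592448336180433765468356053565504 9699331632 368106527866406477613607740078903379530785475705805374325569634950466566363419636617453752937307426351415296)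
  ∷ (765143208 , certificate 925671966573720727071102716937788288 132831104668942304171804841990416593313904652283189678050398183368949760 56535539685501387267190931224531078388805340150743403742899062532210752 3431040000 153664407271334791278185427413636097693785206444993685167215550280619920842223825799559717117167146572480512)
  ∷ (764153208 , certificate 925671966435600997144070013394639744 132831104668942303974511758083786481314684676864827353068722865519460352 56535538039996828390328108212289242095500726799721580457852664497045568 3433137152 153664407271334791278248564152633433888590102326690774664161771274220070161744980321495105636592123564294144)
  ∷ (754163208 , certificate 925677581713749170562012807430162816 995549399252216169314480060728069001257738275896207474783944531446333440 166087069208609491279434391214178131354152098696964934387073278980128832 10800432128 405375880376245139677599294151034811835818005769606717491308367390535600626119454171426091265416400249847808)
  ∷ (654173208 , certificate 924986986946883858991458416340360043 132830816290920681420259811063629118079624364847403911538802952862437376 113501480911993095222539911008146693102086917903468039783536773674045440 1224967696 41856349741818805086905269326212498921541472640195503268542403385771081200327411650426645341090951783841792)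
  ∷ (763154208 , certificate 925671966590342764177907540585110400 132831104668942303594755171923155900618676167074914793925036968457011200 56535538039996828462543918482264031638503984112843981404554212860231744 3433169920 153664407271334791278248564152633433888590102329954867566562845271414680661854165502375747923262072955109376)
  ∷ (753164208 , certificate 925677581733087113728339356113979776 774693516154918128119186884423865065697224243497613120817892768285196288 138480083795328117730533258573121029029872988699131123979148415983419456 10800464896 405375880376245139677599294151034811835818005772870810393709441387730306830644335866249582626194689825472512)
  ∷ (653174208 , certificate 924986986946879136651680553830046571 132830816290920681420259810882822688033100426206485816067999430051631104 113501480911986718508588429244651438384082094389229704154626074538938368 1224968208 41856349741818805086905269326212498921541472640195503268542403388602921694263576251963845388042252809502720)
  ∷ (743165208 , certificate 925677581863650870509496881006004608 774693516154918129071262258061525894192983627957729135118040273893982208 138480083795328117825226779865304954440049666918348528081550104116330560 10800497664 405375880376245139677599294151034811835818005776134903296110515384924917330753521047130224912864639216287744)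
  ∷ (643175208 , certificate 924986986946880011721354350240586603 132830816290920681994987153771666877674911826363385729730597571946614784 113939580045723274226684421291132681397095739448094916763688729125064704 1224968720 41856349741818805086905269326212498921541472640195503268542403391434762188199740853501045434993553835163648)
  ∷ (543176208 , certificate 948352956797242383079187564671125795 1457966114466992965227151732858441401776929985750566666820410134770487296 224805620779530867960065489124754896151376357048608671837242619798753280 9680686096 330837175356567815549931823459029870385181702772462065045463973361893443524988803940319668632462620329410560)
  ∷ (762154308 , certificate 949362454655898569963461938572708224 578425103186420220081588715836898926992413850086659898141956756998193152 28490348259025458761981969932551424780873404207265291161660670506696768 21535786496 2166782817456620060594772847653549080019320905509098344272105556536605179749556764771818917614931679687802880)
  ∷ (752164308 , certificate 925677581733087113584224433254451584 553837633057620086921274696831000251548860154465693031343371292671737856 83266112968765370628989734686176093688554191479028938781921579899027520 11874207232 405375880376245139677599294151034811835818005772870810393709441390561456126022692311532872693474645071953920)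
  ∷ (652174308 , certificate 924986986946879136651679904220961643 132830816290920681420259810882822687368486963565722164295904161381748736 112625282644500853644493481580881481559783042507840965303431176466731008 1258522648 116395054761496129214256963837773243768961769573934164146548334095978273857211217446833031643919877442469888)
  ∷ (742165308 , certificate 925677581863650870365381958146476416 553837633057620087873350070468661080044619538925809045643518798280523776 83266112968765370676541059164608883630693163265063454547001696095043648 11874240000 405375880376245139677599294151034811835818005776134903296110515387756066626131877492413514980144594462769152)
  ∷ (642175308 , certificate 924986986946880011721353700631501675 132830816290920681994987153771666877010298363722622077958502303276732416 113063381778237409362589473628413430122023748919948427035178226254614528 1258523160 116395054761496129214256963837773243768961769573934164146548334098810114351147382048370231690871178468130816)
  ∷ (542176308 , certificate 948352956797242382935072354049050915 1457966114466992965035589790250205294812172511217584853048460991449796608 140670367139682279091396804610079079223001156941973550812278856815742976 11828169752 2129513464946781398530781247338688889899692678039658300701133898873356903631823698572548832817565989108613120)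
  ∷ (732165408 , certificate 925677581863650870392086965281376640 553837633057620087873350070825511677937503308114964383883901141436596224 83266112968765370676921049612958581792255893320329287400915303669956672 11874240512 405375880376245139677599294151034811835818005776134903296110515390587907120068042093950715027095895488430080)
  ∷ (632175408 , certificate 948352956809671503961308274580113699 1457966113849884191839413116678390182973688062790304792332798241419038720 112625282593072459562893085580702415232121148488647660307457354639085568 11828169248 2129513464946781398530844384077686226094497560551630065065599777092794257672328217874329346051917394852577280)
  ∷ (532176408 , certificate 948352956797242382952347958054078755 1457966114466992965035589790607017781080088613412316416486425681694560256 140670367139682279091776702287334196014403457321551534463444284873379840 11828169760 2129513464946781398530844384077686226094497560551630065065599777095626098166264382475865946726053288207351808)
  ∷ (432176508 , certificate 758828417054785427361043249507191659 136713048614650549695342004303673553547380064308314695202154338687913984 28490029005442980563530947087132078306360549226078161865933673153957888 1141083176 112381432183513504068938058099480430165631650414428720893076140487315557192072468100972065829476839182204928)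
  ∷ (765043218 , certificate 952282487973711045381433966333021035 1630106215406330601228234944371124027692831920086908006479172273533620224 111722020660691289546419225758385408171466121029962106460876047192166400 1140950024 112381432183513504068938058099480430165631690719049234741483495901226887283014005286250374869748728094294016)
  ∷ (764053218 , certificate 952283121638828616371483360396069739 1630106215409142742611762438891028863100346631546053959045466064759033856 111722020661494758496736833141198497256908399920718584287876816845672448 1140950024 112381432183513504068938073513723349437163625508083648898100113587928202979761494389107148691585261717454848)
  ∷ (754063218 , certificate 952288103113740162158231051495819555 1019733024302181638763714883212310910014400610535438867487098326716256256 168661428178447374797575466378217845491847489365507898068059020193173504 10754294792 368106527866406477613923346702675464147150281195235478734832494759394997565036269869822145931242871139106816)
  ∷ (654073218 , certificate 949367484410475853747013368376477987 1457966324885580028861589846810375687730748376414479597838949538243022848 196761485689031990614814918293076734913504832233706769402547444881297408 10754294792 2092244112436942736467421091485016658085772907684187903001511125762114418984075878858393981751204832998359040)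
  ∷ (763054218 , certificate 952283121660886642611676076797085987 798877139767554216465208040303076642405672339514008688732481317920837632 140623083567018474087981786596424135608672112713847160627141129772994560 10754327560 368106527866406477613860209963678127952345385316802482140287347762989458745624300528767399698487843538108416)
  ∷ (753064218 , certificate 952288103133078105324557600179636515 798877141204883597568421706908106974453886578136844513521046563555119104 140623083618491591011585517098917907646126329294288289396165863686017024 10754327560 368106527866406477613923346702675464147150281198499571637233568756589608065145455050702788217912820529922048)
  ∷ (653074218 , certificate 949367484429813796913339917060294947 1457966324679891959199058102829665418829001018002495630433901067324887040 168716295830124026180555305737695624773698981180217675322096181280509952 10754327560 2092244112436942736467421091485016658085772907687451995903912199759309029484185064039274624037874782389174272)
  ∷ (743065218 , certificate 952288103263641862105715125071661347 798877141204883598712059022975597948656194355858463429592349567389011968 140623083618491591082713785990772909885316058255070700641012729910923264 10754360328 368106527866406477613923346702675464147150281201763664539634642753784218565254640231583430504582769920737280)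
  ∷ (643075218 , certificate 949367484560377553694497441952319779 1457966324679891960342695418897156393031308795724114546505204071158779904 168716295830123926615902319939902031455542916388854938807889225518157824 10754360328 2092244112436942736467421091485016658085772907690716088806313273756503639984294249220155266324544731779989504)
  ∷ (543076218 , certificate 949366692271158845746667117009193251 1461848557408042938075792609871377536177307235142030514152384670049243136 196761485689081908616416252917265579984581068209594583548303212697620480 10754393096 2092244112436942736467421091485016658085772907693980181708714347753698250484403434401035908611214681170804736)
  ∷ (762054318 , certificate 952283121660886642467561703693371683 578021256670256175267295852710211828257308250477252895979501325608554496 84546394498541674292184736538535586943307990652238986907536383631953920 11828069896 405375880376245139677536049512337040740289566390787050401023166405858795975998343261442401233478686970281984)
  ∷ (752064318 , certificate 952288103133078105180443227075922211 578021258107585556370509519315242160305522489100088720768066571242835968 84546394498580023436612648729188344144020330884990652706331555673935872 11828069896 405375880376245139677599186251334376935094462272484139897969387399458945295519497783377789752903663962095616)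
  ∷ (652074318 , certificate 949367484429813796769225543956580643 1457966324474203889533907347560294271339403602952350224241924367255605248 112625916112308296534211712219668725562657416980925675157295380411453440 11828069896 2092244112436942736467421091485016658085772907687451995903912199762140869978121228640811824084826083414835200)
  ∷ (742065318 , certificate 952288103263641861961600751967947043 578021258107585557514146835382733134507830266821707636839369575076728832 84546394498580023460598720807292210915172353412892407068760507255623680 11828102664 405375880376245139677599186251334376935094462275748232800370461396653555795628682964258432039573613352910848)
  ∷ (642075318 , certificate 949367484560377553550383068848605475 1457966324474203890677544663627785245541711380673969140313227371089498112 112625916112308196922416529608123996776463645756682281760670510005882880 11828102664 2092244112436942736467421091485016658085772907690716088806313273759335480478230413821692466371496032805650432)
  ∷ (542076318 , certificate 949366692271158845602552743905478947 1461848557408042937884230667263141429212585254820938443212263062625587200 140671105972069647945054018945609176852607295350764148648713404994293760 11828135432 2092244112436942736467421091485016658085772907693980181708714347756530090978339599002573108658165982196465664)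
  ∷ (732065418 , certificate 952288103263641861988305759102847267 578021258107585557514146835917989693822805521670034237147962927745601536 84546394498580023460978711255641909076410484448397259646173090366885888 11828103176 405375880376245139677599186251334376935094462275748232800370461399485396289564847565795632086524914378571776)
  ∷ (632075418 , certificate 949367484560377553577088075983505699 1457966324474203890677544664163041804856686635522295740621820723758370816 112625916112308196922796520056473694937701776792187134338083093117145088 11828103176 2092244112436942736467421091485016658085772907690716088806313273762167320972166578423229666418447333831311360)
  ∷ (532076418 , certificate 949366692271158845629257751040379171 1461848557408042937884230667798397988527560509669265043520856415294459904 140671105972477659558222358859409528215616026436065909848675038010019840 11828135944 2092244112436942736467421091485016658085772907693980181708714347759361931472275763604110308705117283222126592)
  ∷ (432076518 , certificate 759518980851388672371732965127900011 136713259235630830413591753368187764734500147260543155489501772270538752 28490346590283167436527739809408610894093011156194463660585075094327296 1141049864 112381432183513504068938104342209187980227535195326061915730626497200180690607121287139475542821132482772992)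
  ∷ (761054328 , certificate 952283121660886642467561703673547187 357165373572958134069383665117347013778872763370521116396630050378612736 28469705378642857032209511965935946674581699217612615694581555854835712 12935366160 2166782817456620060594646512518582730543583412857796477788025688482315923502026560791810233301853754064175104)
  ∷ (751064328 , certificate 952288103133078105180443227056097715 357165375010287515172597331722377345827087001993356941185195296012894208 28469705378668455813749294662090476014238553817222393383414864778625024 12935366160 2166782817456620060594709649257580066738388308739493567284971909475916072821547715313745621821278731055988736)
  ∷ (651074328 , certificate 949367484429813796769225543936756147 1457966324268515819868756592290923123519734789832228831220056384268664832 56535536394492566839977633004273521723940074123163052359412196659167232 12935366160 2166782817456620060594772785996577402933193204621190656781918130469516222141068869835681010340703708047802368)
  ∷ (741065328 , certificate 952288103263641861961600751948122547 357165375010287516316234647789868320029394779714975857256498299846787072 28469705378668455837723674727106584597786416897293245469124385482735616 12935398928 2166782817456620060594709649257580066738388308742757660187372983473110683321656900494626264107948680446803968)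
  ∷ (641075328 , certificate 949367484560377553550383068828780979 1457966324268515821012393908358414097722042567553847747291359388102557696 56535536394492467228170758379641034750142143451088756686067895376019456 12935398928 2166782817456620060594772785996577402933193204624454749684319204466710832641178055016561652627373657438617600)
  ∷ (541076328 , certificate 949366692271158845602552743885654451 1461848557408042937692668724654905321917791876429870385442250172284272640 84580726254241364047349166368697190470785007191000149127379109755748352 12935431696 2166782817456620060594772785996577402933193204627718842586720278463905443141287240197442294914043606829432832)
  ∷ (731065428 , certificate 952288103263641861988305759083022771 357165375010287516316234648325124879344370034563302457565091652515659776 28469705378668455838103665175456282760003093730067015228291685380259840 12935399440 2166782817456620060594709649257580066738388308742757660187372983475942523815593065096163464154899981472464896)
  ∷ (631075428 , certificate 949367484560377553577088075963681203 1457966324268515821012393908893670657037017822402174347599952740771430400 56535536394492467228550748827990732912358820283862526445235195273543680 12935399440 2166782817456620060594772785996577402933193204624454749684319204469542673135114219618098852674324958464278528)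
  ∷ (531076428 , certificate 949366692271158845629257751020554675 1461848557408042937692668725190161881232767131278196985750843524953145344 84580726254649375660517506282497541834772284073570827509095459557736448 12935432208 2166782817456620060594772785996577402933193204627718842586720278466737283635223404798979494960994907855093760)
  ∷ (431076528 , certificate 925677550926904069402310436428564915 1437261086047601554778027050448866491203173383133300556312848925039001600 193694054569651843439448178191632258136849911873562290891932302219149312 9714207248 405375880376245139677283610456048130861793595073545739837673478951148772645351739421401459611126988038864896)
  ∷ (721065438 , certificate 931518192894285586207189167276411315 332577903652658274404318863677183733666869454085388193145343618534342656 55645331644459199790702353996635104827232897710123037120143539646234624 11861657624 405375880376245139677346731780802547785066529426758561810723646974760202710594717991088873295256819008110592)
  ∷ (621075438 , certificate 925676996339778265802302872708827571 1437261085230956271230910174418260338176520990721105925617483626666000384 83266112916099998202298795282359395878336587342961785040351278726643712 11861657624 405375880376245139677346747195045467056598464215792975967340264661461518407342207093945647117093352631271424)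
  ∷ (521076438 , certificate 925677550926904448708982379663444403 1437261086047601554203299707560022301893669516245868866091975603510050816 110873098329808016954446948889119217629209139300648377852890243391291392 11861690392 405375880376245139677346747195045467056598477585517504202139357170586126685856258723181972845478393782829056)
  ∷ (421076538 , certificate 925677550926904069402310963638159795 1437261086047601554778027050448866491535480916402768779754573745405034496 138480083743089292449443399442154482705298638149451502635433803267440640 11861690904 405375880376245139677346747195045467056598477585517504202139357173417967179792423324718573519614287137603584)
  ∷ (321076548 , certificate 783208122040906541246983763308170163 112125787878805057903562049126810058495326462657949855353445096372568064 28052142142202231208599348373682039883084299406826365664444355526524928 3288533536 112381432183513504069379999858218864257733985151770074711843662443333675253043072436984742619148204789334016)
  ∷ []

certificateOf : Shape → Certificate
certificateOf s = lookupCertificate (key s) certificateTable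

-- Opaque because type checking reduces types such as T (allUpTo 9 checkShapes),
-- which must not run the certificate checks.
opaque
  certified : Shape → Bool
  certified s = MinorCertificate.valid (Shape.width s) 5 6 (shortAdj s) (certificateOf s)

  certified-valid : ∀ s → T (certified s) → T (MinorCertificate.valid (Shape.width s) 5 6 (shortAdj s) (certificateOf s))
  certified-valid s p = p

shapeCheck : Shape → Bool
shapeCheck s = not (reduced s) ∨ certified s

checkBottoms : ℕ → ℕ → ℕ → ℕ → ℕ → Bool
checkBottoms w t₁ t₂ t₃ t₄ = allIncreasing4 w λ b₁ b₂ b₃ b₄ → shapeCheck (shape w t₁ t₂ t₃ t₄ b₁ b₂ b₃ b₄)

checkShapes : ℕ → Bool
checkShapes w = allIncreasing4 w (checkBottoms w)

opaque
  unfolding certified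
  shapes-certified : T (allUpTo 9 checkShapes)
  shapes-certified = _

shortCylinderMinor : ∀ {w t₁ t₂ t₃ t₄ b₁ b₂ b₃ b₄} → w < 9 →
                     t₁ < t₂ → t₂ < t₃ → t₃ < t₄ → t₄ < w → b₁ < b₂ → b₂ < b₃ → b₃ < b₄ → b₄ < w →
                     T (reduced (shape w t₁ t₂ t₃ t₄ b₁ b₂ b₃ b₄)) →
                     KMinor 6 (ShortCylinder (shape w t₁ t₂ t₃ t₄ b₁ b₂ b₃ b₄))
shortCylinderMinor {w} {t₁} {t₂} {t₃} {t₄} {b₁} {b₂} {b₃} {b₄} w<9 t₁₂ t₂₃ t₃₄ t₄w b₁₂ b₂₃ b₃₄ b₄w red =
  certifiedMinor w 5 6 (shortAdj s) (shortAdj-sym s) (certificateOf s) (certified-valid s (implication-elim red checked))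
  where
  s : Shape
  s = shape w t₁ t₂ t₃ t₄ b₁ b₂ b₃ b₄
  checked : T (shapeCheck s)
  checked = allIncreasing4-sound w (λ b₁ b₂ b₃ b₄ → shapeCheck (shape w t₁ t₂ t₃ t₄ b₁ b₂ b₃ b₄))
              (allIncreasing4-sound w (checkBottoms w) (allUpTo-sound 9 checkShapes shapes-certified w w<9) t₁₂ t₂₃ t₃₄ t₄w)
              b₁₂ b₂₃ b₃₄ b₄w

record CrossingChords (t : ℕ) (Chord : Fin t → Fin t → Set) : Set where
  constructor crossing
  field
    a₁ a₂ a₃ a₄ : Fin t
    a₁<a₂   : toℕ a₁ < toℕ a₂
    a₂<a₃   : toℕ a₂ < toℕ a₃
    a₃<a₄   : toℕ a₃ < toℕ a₄
    chord₁₃ : Chord a₁ a₃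
    chord₂₄ : Chord a₂ a₄

sortCrossing : ∀ {t} {Chord : Fin t → Fin t → Set} → (∀ {a b} → Chord a b → Chord b a) →
               ∀ {u₁ v₁ u₂ v₂} → CyclicOrder4 u₁ u₂ v₁ v₂ → Chord u₁ v₁ → Chord u₂ v₂ →
               CrossingChords t Chord
sortCrossing sym {u₁} {v₁} {u₂} {v₂} (inj₁ (p , q , r))               c₁ c₂ = crossing u₁ u₂ v₁ v₂ p q r c₁ c₂
sortCrossing sym {u₁} {v₁} {u₂} {v₂} (inj₂ (inj₁ (p , q , r)))        c₁ c₂ = crossing u₂ v₁ v₂ u₁ p q r c₂ (sym c₁)
sortCrossing sym {u₁} {v₁} {u₂} {v₂} (inj₂ (inj₂ (inj₁ (p , q , r)))) c₁ c₂ = crossing v₁ v₂ u₁ u₂ p q r (sym c₁) (sym c₂)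
sortCrossing sym {u₁} {v₁} {u₂} {v₂} (inj₂ (inj₂ (inj₂ (p , q , r)))) c₁ c₂ = crossing v₂ u₁ u₂ v₁ p q r (sym c₂) c₁

module Cylinder (t l : ℕ) (u₁ v₁ u₂ v₂ x₁ y₁ x₂ y₂ : Fin t) where

  G : Graph
  G = DoubleCrossedCylinder t l u₁ v₁ u₂ v₂ x₁ y₁ x₂ y₂

  Edge : V G → V G → Set
  Edge = Adj G

  edge-sym : ∀ {x y} → Edge x y → Edge y x
  edge-sym (inj₁ e) = inj₂ e
  edge-sym (inj₂ e) = inj₁ e

  TopChord BottomChord : Fin t → Fin t → Set
  TopChord    a b = ∀ j → toℕ j ≡ 0      → Edge (a , j) (b , j)
  BottomChord a b = ∀ j → toℕ j ≡ pred l → Edge (a , j) (b , j)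

  topCrossing : CyclicOrder4 u₁ u₂ v₁ v₂ → CrossingChords t TopChord
  topCrossing order = sortCrossing (λ chord j j≡0 → edge-sym (chord j j≡0)) order
                        (λ j j≡0 → inj₁ (q₁ j j≡0)) (λ j j≡0 → inj₁ (q₂ j j≡0))

  bottomCrossing : CyclicOrder4 x₁ x₂ y₁ y₂ → CrossingChords t BottomChord
  bottomCrossing order = sortCrossing (λ chord j j≡l → edge-sym (chord j j≡l)) order
                           (λ j j≡l → inj₁ (r₁ j j≡l)) (λ j j≡l → inj₁ (r₂ j j≡l))

  rowWalk : ∀ {P : V G → Set} j (i i' : Fin t) → toℕ i ≤ toℕ i' →
            (∀ k → toℕ i ≤ toℕ k → toℕ k ≤ toℕ i' → P (k , j)) → WalkIn Edge P (i , j) (i' , j)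
  rowWalk j = lineWalk (_, j) (λ a b b≡a+1 → inj₁ (rung a b j b≡a+1))

  columnWalk : ∀ {P : V G → Set} i (j j' : Fin l) → toℕ j ≤ toℕ j' →
               (∀ m → toℕ j ≤ toℕ m → toℕ m ≤ toℕ j' → P (i , m)) → WalkIn Edge P (i , j) (i , j')
  columnWalk i = lineWalk (i ,_) (λ a b b≡a+1 → inj₁ (path i a b b≡a+1))

  ends : ∀ {C} → CrossingChords t C → List ℕ
  ends ch = toℕ a₁ ∷ toℕ a₂ ∷ toℕ a₃ ∷ toℕ a₄ ∷ [] where open CrossingChords ch

  module Squashed (5≤l : 5 ≤ l) (top : CrossingChords t TopChord) (bottom : CrossingChords t BottomChord)
                  (marks : List ℕ) (ends⊆marks : ∀ {c} → c ∈ ends top ++ ends bottom → c ∈ marks) where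

    module Top    = CrossingChords top
    module Bottom = CrossingChords bottom

    marked : ℕ → Bool
    marked c = isIn c marks

    open Squash marked public

    marked-end : ∀ {c} → c ∈ ends top ++ ends bottom → T (marked c)
    marked-end c∈ = isIn-complete (ends⊆marks c∈)

    width : ℕ
    width = count t

    0<width : 0 < width
    0<width = <-≤-trans (subst (0 <_) (sym (count-marked {toℕ Top.a₁} (marked-end (here refl)))) z<s) (count-mono (toℕ<n Top.a₁))

    squashed : Shape
    squashed = shape width
      (squash (toℕ Top.a₁))    (squash (toℕ Top.a₂))    (squash (toℕ Top.a₃))    (squash (toℕ Top.a₄))
      (squash (toℕ Bottom.a₁)) (squash (toℕ Bottom.a₂)) (squash (toℕ Bottom.a₃)) (squash (toℕ Bottom.a₄))

    H : Graph
    H = ShortCylinder squashed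

    φ : V G → V H
    φ (i , j) = fromℕ< (squash-< (toℕ<n i) 0<width) , fromℕ< (s≤s (m⊓n≤n (toℕ j) 4))

    φ-≡ : ∀ i j {c r} → squash (toℕ i) ≡ toℕ c → toℕ j ⊓ 4 ≡ toℕ r → φ (i , j) ≡ (c , r)
    φ-≡ i j ec er = cong₂ _,_ (toℕ-injective (trans (toℕ-fromℕ< _) ec)) (toℕ-injective (trans (toℕ-fromℕ< _) er))

    φ-column : ∀ {i j i' j'} → φ (i , j) ≡ φ (i' , j') → squash (toℕ i) ≡ squash (toℕ i')
    φ-column eq = trans (sym (toℕ-fromℕ< _)) (trans (cong (toℕ ∘′ proj₁) eq) (toℕ-fromℕ< _))

    φ-row : ∀ {i j i' j'} → φ (i , j) ≡ φ (i' , j') → toℕ j ⊓ 4 ≡ toℕ j' ⊓ 4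
    φ-row eq = trans (sym (toℕ-fromℕ< _)) (trans (cong (toℕ ∘′ proj₂) eq) (toℕ-fromℕ< _))

    fibre-walk : ∀ x y → φ x ≡ φ y → WalkIn Edge (λ v → φ v ≡ φ x) x y
    fibre-walk (i , j) (i' , j') eq = alongRow ++ʷ alongColumn
      where
      sameColumn = φ-column {i} {j} {i'} {j'} eq
      sameRow    = φ-row {i} {j} {i'} {j'} eq

      inFibre : ∀ k m → squash (toℕ k) ≡ squash (toℕ i) → toℕ m ⊓ 4 ≡ toℕ j ⊓ 4 → φ (k , m) ≡ φ (i , j)
      inFibre k m ek em = φ-≡ k m (trans ek (sym (toℕ-fromℕ< _))) (trans em (sym (toℕ-fromℕ< _)))

      alongRow : WalkIn Edge (λ v → φ v ≡ φ (i , j)) (i , j) (i' , j)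
      alongRow with ≤-total (toℕ i) (toℕ i')
      ... | inj₁ i≤i' = rowWalk j i i' i≤i' λ k i≤k k≤i' →
              inFibre k j (flat-between {squash} squash-mono i≤k k≤i' sameColumn) refl
      ... | inj₂ i'≤i = walk-reverse edge-sym (rowWalk j i' i i'≤i λ k i'≤k k≤i →
              inFibre k j (trans (flat-between {squash} squash-mono i'≤k k≤i (sym sameColumn)) (sym sameColumn)) refl)

      alongColumn : WalkIn Edge (λ v → φ v ≡ φ (i , j)) (i' , j) (i' , j')
      alongColumn with ≤-total (toℕ j) (toℕ j')
      ... | inj₁ j≤j' = columnWalk i' j j' j≤j' λ m j≤m m≤j' →
              inFibre i' m (sym sameColumn) (flat-between {_⊓ 4} (⊓-monoˡ-≤ 4) j≤m m≤j' sameRow)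
      ... | inj₂ j'≤j = walk-reverse edge-sym (columnWalk i' j' j j'≤j λ m j'≤m m≤j →
              inFibre i' m (sym sameColumn) (trans (flat-between {_⊓ 4} (⊓-monoˡ-≤ 4) j'≤m m≤j (sym sameRow)) (sym sameRow)))

    0<t : 0 < t
    0<t = ≤-<-trans z≤n (toℕ<n Top.a₁)

    lowRow : ∀ r → r < 5 → Fin l
    lowRow r r<5 = fromℕ< (<-≤-trans r<5 5≤l)

    lowRow-row : ∀ r r<5 → toℕ (lowRow r r<5) ⊓ 4 ≡ r
    lowRow-row r r<5 = trans (cong (_⊓ 4) (toℕ-fromℕ< _)) (m≤n⇒m⊓n≡m (s≤s⁻¹ r<5))

    lastRow : Fin l
    lastRow = fromℕ< (pred-< (<-≤-trans z<s 5≤l))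

    lastRow-row : toℕ lastRow ⊓ 4 ≡ 4
    lastRow-row = trans (cong (_⊓ 4) (toℕ-fromℕ< _)) (m≥n⇒m⊓n≡n (pred-mono-≤ 5≤l))

    column : (c : Fin width) → ∃[ i ] squash (toℕ i) ≡ toℕ c
    column c = let (s , s<t , _ , eq) = squash-hit {t} (toℕ<n c) in
               fromℕ< s<t , trans (cong squash (toℕ-fromℕ< s<t)) eq

    Lift : V H → V H → Set
    Lift h h' = ∃₂ λ x y → φ x ≡ h × φ y ≡ h' × Edge x y

    liftArc : ∀ c r c' r' → Arc squashed (toℕ c) (toℕ r) (toℕ c') (toℕ r') → Lift (c , r) (c' , r')
    liftArc c r c' r' (down c≡c' r'≡r+1) =
      (i , row) , (i , row') , φ-≡ i row i≡c (lowRow-row _ r<5) ,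
      φ-≡ i row' (trans i≡c c≡c') (trans (lowRow-row _ r+1<5) (sym r'≡r+1)) ,
      inj₁ (path i row row' (trans (toℕ-fromℕ< _) (cong suc (sym (toℕ-fromℕ< _)))))
      where
      i = proj₁ (column c)
      i≡c = proj₂ (column c)
      r<5 = toℕ<n r
      r+1<5 = subst (_< 5) r'≡r+1 (toℕ<n r')
      row = lowRow (toℕ r) r<5
      row' = lowRow (suc (toℕ r)) r+1<5
    liftArc c r c' r' (right r≡r' c'≡c+1) =
      (i , row) , (i' , row) , φ-≡ i row (trans (cong squash (toℕ-fromℕ< s<t)) s≡c) (lowRow-row _ r<5) ,
      φ-≡ i' row (trans (cong squash (toℕ-fromℕ< s+1<t)) (trans s+1≡c+1 (sym c'≡c+1))) (trans (lowRow-row _ r<5) r≡r') ,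
      inj₁ (rung i i' row (trans (toℕ-fromℕ< s+1<t) (cong suc (sym (toℕ-fromℕ< s<t)))))
      where
      r<5 = toℕ<n r
      row = lowRow (toℕ r) r<5
      boundary = squash-step {t} (subst (_< width) c'≡c+1 (toℕ<n c'))
      s = proj₁ boundary
      s+1<t = proj₁ (proj₂ boundary)
      s<t = <-trans (n<1+n s) s+1<t
      s≡c = proj₁ (proj₂ (proj₂ boundary))
      s+1≡c+1 = proj₂ (proj₂ (proj₂ boundary))
      i = fromℕ< s<t
      i' = fromℕ< s+1<t
    liftArc c r c' r' (around r≡r' c≡w-1 c'≡0) =
      (last , row) , (first , row) ,
      φ-≡ last row (trans (cong squash (toℕ-fromℕ< t-1<t)) (trans (cong (pred ∘′ count) t-1+1≡t) (sym c≡w-1))) (lowRow-row _ r<5) ,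
      φ-≡ first row (trans (cong squash (toℕ-fromℕ< 0<t)) (trans squash-zero (sym c'≡0))) (trans (lowRow-row _ r<5) r≡r') ,
      inj₁ (wrap last first row (trans (cong suc (toℕ-fromℕ< t-1<t)) t-1+1≡t) (toℕ-fromℕ< 0<t))
      where
      r<5 = toℕ<n r
      row = lowRow (toℕ r) r<5
      t-1<t = pred-< 0<t
      t-1+1≡t = suc-pred t {{>-nonZero 0<t}}
      last = fromℕ< t-1<t
      first = fromℕ< 0<t
    liftArc c r c' r' (top₁₃ r≡0 r'≡0 c≡ c'≡) =
      (Top.a₁ , row₀) , (Top.a₃ , row₀) , φ-≡ Top.a₁ row₀ (sym c≡) (trans (lowRow-row 0 z<s) (sym r≡0)) ,
      φ-≡ Top.a₃ row₀ (sym c'≡) (trans (lowRow-row 0 z<s) (sym r'≡0)) , Top.chord₁₃ row₀ (toℕ-fromℕ< _)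
      where row₀ = lowRow 0 z<s
    liftArc c r c' r' (top₂₄ r≡0 r'≡0 c≡ c'≡) =
      (Top.a₂ , row₀) , (Top.a₄ , row₀) , φ-≡ Top.a₂ row₀ (sym c≡) (trans (lowRow-row 0 z<s) (sym r≡0)) ,
      φ-≡ Top.a₄ row₀ (sym c'≡) (trans (lowRow-row 0 z<s) (sym r'≡0)) , Top.chord₂₄ row₀ (toℕ-fromℕ< _)
      where row₀ = lowRow 0 z<s
    liftArc c r c' r' (bottom₁₃ r≡4 r'≡4 c≡ c'≡) =
      (Bottom.a₁ , lastRow) , (Bottom.a₃ , lastRow) , φ-≡ Bottom.a₁ lastRow (sym c≡) (trans lastRow-row (sym r≡4)) ,
      φ-≡ Bottom.a₃ lastRow (sym c'≡) (trans lastRow-row (sym r'≡4)) , Bottom.chord₁₃ lastRow (toℕ-fromℕ< _)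
    liftArc c r c' r' (bottom₂₄ r≡4 r'≡4 c≡ c'≡) =
      (Bottom.a₂ , lastRow) , (Bottom.a₄ , lastRow) , φ-≡ Bottom.a₂ lastRow (sym c≡) (trans lastRow-row (sym r≡4)) ,
      φ-≡ Bottom.a₄ lastRow (sym c'≡) (trans lastRow-row (sym r'≡4)) , Bottom.chord₂₄ lastRow (toℕ-fromℕ< _)

    lift-edge : ∀ h h' → Adj H h h' → Lift h h'
    lift-edge (c , r) (c' , r') e with ∨⁻ {arc squashed (toℕ c) (toℕ r) (toℕ c') (toℕ r')} e
    ... | inj₁ a = liftArc c r c' r' (arc-cases squashed _ _ _ _ a)
    ... | inj₂ a = let (y , x , φy , φx , e') = liftArc c' r' c r (arc-cases squashed _ _ _ _ a) in
                   x , y , φx , φy , edge-sym e'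

    contraction : Contraction G H
    contraction = record
      { φ          = φ
      ; section    = λ { (c , r) → proj₁ (column c) , lowRow _ (toℕ<n r) }
      ; φ-section  = λ { (c , r) → φ-≡ (proj₁ (column c)) (lowRow _ (toℕ<n r)) (proj₂ (column c)) (lowRow-row _ (toℕ<n r)) }
      ; fibre-walk = fibre-walk
      ; lift-edge  = lift-edge
      }

    column-covered : ∀ c → c < width → c ∈ map squash marks
    column-covered c c<width =
      let (s , _ , ms , s≡c) = squash-hit {t} c<width in subst (_∈ map squash marks) s≡c (∈-map⁺ squash (isIn-sound {s} ms))

    width-bound : width ≤ length marks
    width-bound = subst (width ≤_) (length-map squash marks) (covered-≤-length width (map squash marks) column-covered)

    minor : width < 9 → T (reduced squashed) → KMinor 6 G
    minor width<9 red = liftMinor contraction (shortCylinderMinor width<9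
      (squash-strict m₁ m₂ Top.a₁<a₂) (squash-strict m₂ m₃ Top.a₂<a₃) (squash-strict m₃ m₄ Top.a₃<a₄) (squash-< (toℕ<n Top.a₄) 0<width)
      (squash-strict m₅ m₆ Bottom.a₁<a₂) (squash-strict m₆ m₇ Bottom.a₂<a₃) (squash-strict m₇ m₈ Bottom.a₃<a₄) (squash-< (toℕ<n Bottom.a₄) 0<width)
      red)
      where
      m₁ = marked-end (here refl)
      m₂ = marked-end (there (here refl))
      m₃ = marked-end (there (there (here refl)))
      m₄ = marked-end (there (there (there (here refl))))
      m₅ = marked-end (there (there (there (there (here refl)))))
      m₆ = marked-end (there (there (there (there (there (here refl))))))
      m₇ = marked-end (there (there (there (there (there (there (here refl)))))))
      m₈ = marked-end (there (there (there (there (there (there (there (here refl))))))))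

  module Main (5≤t : 5 ≤ t) (5≤l : 5 ≤ l) (top : CrossingChords t TopChord) (bottom : CrossingChords t BottomChord) where

    tops bottoms : List ℕ
    tops    = ends top
    bottoms = ends bottom

    distinctChords : tops ≢ bottoms → KMinor 6 G
    distinctChords differ = minor (s≤s width-bound) (∨⁺ (inj₁ (∧⁺ covered (not⁺ differentChords))))
      where
      open Squashed 5≤l top bottom (tops ++ bottoms) (λ c∈ → c∈)
      covered : T (coveredByChords squashed)
      covered = allUpTo-complete width _ (λ c c<width → isIn-complete (column-covered c c<width))
      differentChords : ¬ T (sameChords squashed)
      differentChords same =
        differ (squash-list-injective (λ c∈ → marked-end (∈-++⁺ˡ c∈)) (λ c∈ → marked-end (∈-++⁺ʳ tops c∈)) (toWitness same))

    coincidingChords : tops ≡ bottoms → KMinor 6 G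
    coincidingChords same = minor (≤-trans (s≤s width-bound) (m≤m+n 6 3)) (∨⁺ (inj₂ (∧⁺ sameEnds spareColumn)))
      where
      e = proj₁ (fresh tops)
      e<t : e < t
      e<t = <-≤-trans (s≤s (proj₁ (proj₂ (fresh tops)))) 5≤t
      e∉tops : e ∉ tops
      e∉tops = proj₂ (proj₂ (fresh tops))
      ends⊆marks : ∀ {c} → c ∈ tops ++ bottoms → c ∈ e ∷ tops
      ends⊆marks {c} c∈ with ∈-++⁻ tops c∈
      ... | inj₁ c∈tops    = there c∈tops
      ... | inj₂ c∈bottoms = there (subst (c ∈_) (sym same) c∈bottoms)
      open Squashed 5≤l top bottom (e ∷ tops) ends⊆marks
      sameEnds : T (sameChords squashed)
      sameEnds = fromWitness (cong (map squash) same)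
      spare : T (coveredWithSpare squashed (squash e))
      spare = ∧⁺ (allUpTo-complete width _ (λ c c<width → isIn-complete (column-covered c c<width)))
                 (not⁺ λ ε∈ → e∉tops (squash-∈ (isIn-complete {e} {e ∷ tops} (here refl)) (λ {y} y∈ → isIn-complete {y} {e ∷ tops} (there y∈)) (isIn-sound ε∈)))
      spareColumn : T (anyUpTo width (coveredWithSpare squashed))
      spareColumn = anyUpTo-complete width _ (squash e) (squash-< e<t 0<width) spare

    kminor : KMinor 6 G
    kminor with ≡-dec _≟_ tops bottoms
    ... | yes same  = coincidingChords same
    ... | no differ = distinctChords differ

lemma8p1 : (t l : ℕ) → 5 ≤ t → 16 ≤ l →
    (u₁ v₁ u₂ v₂ x₁ y₁ x₂ y₂ : Fin t) →
    CyclicOrder4 u₁ u₂ v₁ v₂ → CyclicOrder4 x₁ x₂ y₁ y₂ →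
    HasKMinor 6 (DoubleCrossedCylinder t l u₁ v₁ u₂ v₂ x₁ y₁ x₂ y₂)
lemma8p1 t l 5≤t 16≤l u₁ v₁ u₂ v₂ x₁ y₁ x₂ y₂ topOrder bottomOrder =
  Main.kminor 5≤t (≤-trans (m≤m+n 5 11) 16≤l) (topCrossing topOrder) (bottomCrossing bottomOrder)
  where open Cylinder t l u₁ v₁ u₂ v₂ x₁ y₁ x₂ y₂
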